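{- Let $r\geq 4$ be even and let $H$ be $K_r$ with a rotated edge. Then for any integer $t\geq\binom{r}{2}$, $\operatorname{sat}_t(n,\mathfrak{R}(H))=O(n)$ as $n\to\infty$.
   Context: "$K_r$ with a rotated edge" is obtained from a copy of $K_r$ by adding one new vertex $w$ and replacing one edge $uv$ of the clique by the edge $uw$. A $t$-edge-coloured graph is a graph $G$ with a function $c:E(G)\to\{1,\dots,t\}$ (not necessarily proper). A copy of $H$ is rainbow if all its edges receive distinct colours; $\mathfrak{R}(H)$ denotes the family of rainbow copies of $H$. A $t$-edge-coloured graph is $\mathfrak{R}(H)$-saturated if it contains no rainbow copy of $H$ but adding any non-edge in any colour from $\{1,\dots,t\}$ creates a rainbow copy of $H$. $\operatorname{sat}_t(n,\mathfrak{R}(H))$ is the minimum number of edges of such a graph on $n$ vertices. -}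

module Defs where

open import Data.Nat using (ℕ; zero; suc; _+_; _*_; _≤_)
open import Data.Fin using (Fin; toℕ; fromℕ; inject₁; _<?_) renaming (zero to fz; suc to fs)
open import Data.Fin.Properties using (_≟_)
open import Data.Maybe using (Maybe; just; nothing; is-just)
open import Data.Bool using (Bool; true; false; if_then_else_; _∧_; not)
open import Data.List using (List; map; allFin)
open import Data.Nat.ListAction using (sum)
open import Data.Product using (Σ; ∃; _×_; _,_)
open import Data.Sum using (_⊎_)
open import Relation.Nullary using (¬_; Dec; yes; no; does)
open import Relation.Binary.PropositionalEquality using (_≡_; _≢_)
open import Function.Definitions using (Injective)

-- A t-edge-coloured (simple) graph on vertex set Fin n:
-- c i j ≡ nothing means ij is a non-edge, c i j ≡ just k means ij is an edge of colour k.
record ColGraph (n t : ℕ) : Set where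
  field
    col   : Fin n → Fin n → Maybe (Fin t)
    sym   : ∀ i j → col i j ≡ col j i
    irref : ∀ i → col i i ≡ nothing
open ColGraph public

record Graph (m : ℕ) : Set where
  field
    adj   : Fin m → Fin m → Bool
    sym   : ∀ i j → adj i j ≡ adj j i
    irref : ∀ i → adj i i ≡ false
open Graph public

edgeCount : ∀ {n t} → ColGraph n t → ℕ
edgeCount {n} G =
  sum (map (λ i → sum (map (λ j → if does (i <? j) ∧ is-just (col G i j) then 1 else 0)
                           (allFin n)))
           (allFin n))

RainbowCopy : ∀ {m n t} → Graph m → ColGraph n t → (Fin m → Fin n) → Set
RainbowCopy H G φ =
  Injective _≡_ _≡_ φ
  × (∀ x y → adj H x y ≡ true → ∃ λ k → col G (φ x) (φ y) ≡ just k)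
  × (∀ x y x' y' → adj H x y ≡ true → adj H x' y' ≡ true →
       col G (φ x) (φ y) ≡ col G (φ x') (φ y') →
       (x ≡ x' × y ≡ y') ⊎ (x ≡ y' × y ≡ x'))

HasRainbowCopy : ∀ {m n t} → Graph m → ColGraph n t → Set
HasRainbowCopy H G = ∃ λ φ → RainbowCopy H G φ

addEdge : ∀ {n t} → ColGraph n t → (i j : Fin n) → i ≢ j → Fin t → ColGraph n t
addEdge {n} {t} G i j i≢j k = record { col = c ; sym = s ; irref = ir }
  where
  hit : Fin n → Fin n → Bool
  hit a b = (does (a ≟ i) ∧ does (b ≟ j)) Data.Bool.∨ (does (a ≟ j) ∧ does (b ≟ i))
  c : Fin n → Fin n → Maybe (Fin t)
  c a b = if hit a b then just k else col G a b
  open import Data.Bool.Properties using (∧-comm; ∨-comm)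
  open import Relation.Binary.PropositionalEquality using (refl; cong₂; trans; sym)
  hit-sym : ∀ a b → hit a b ≡ hit b a
  hit-sym a b = trans (cong₂ Data.Bool._∨_ (∧-comm (does (a ≟ i)) (does (b ≟ j)))
                                           (∧-comm (does (a ≟ j)) (does (b ≟ i))))
                      (∨-comm (does (b ≟ j) ∧ does (a ≟ i)) (does (b ≟ i) ∧ does (a ≟ j)))
  s : ∀ a b → c a b ≡ c b a
  s a b rewrite hit-sym a b with hit b a
  ... | true  = refl
  ... | false = ColGraph.sym G a b
  hit-diag : ∀ a → hit a a ≡ false
  hit-diag a with a ≟ i | a ≟ j
  ... | yes refl | yes refl = Data.Empty.⊥-elim (i≢j refl)
    where import Data.Empty
  ... | yes _ | no _ = refl
  ... | no _ | yes _ = refl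
  ... | no _ | no _ = refl
  ir : ∀ a → c a a ≡ nothing
  ir a rewrite hit-diag a = irref G a

Saturated : ∀ {m n t} → Graph m → ColGraph n t → Set
Saturated {n = n} {t = t} H G =
  ¬ HasRainbowCopy H G
  × (∀ (i j : Fin n) (i≢j : i ≢ j) → col G i j ≡ nothing →
       ∀ (k : Fin t) → HasRainbowCopy H (addEdge G i j i≢j k))

-- sat_t(n, 𝔑(H)) ≤ s  (unfolding of: the minimum number of edges of an
-- 𝔑(H)-saturated t-edge-coloured graph on n vertices is at most s)
SatAtMost : ℕ → ∀ {m} → Graph m → ℕ → ℕ → Set
SatAtMost t H n s = Σ (ColGraph n t) λ G → Saturated H G × edgeCount G ≤ s

-- K_r with a rotated edge, on vertex set Fin (suc r): vertices 0,…,r-1 form a K_r,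
-- vertex r is the new vertex w; the clique edge uv with u = 0, v = 1 is replaced by
-- uw = {0, r}.
rotAdj : (r : ℕ) → Fin (suc r) → Fin (suc r) → Bool
rotAdj r a b =
  if does (a ≟ b) then false else
  if isW a ∨' isW b then (isU a ∨' isU b)
  else not (isUV a b ∨' isUV b a)
  where
  _∨'_ = Data.Bool._∨_
  isW : Fin (suc r) → Bool
  isW x = does (toℕ x Data.Nat.≟ r)
  isU : Fin (suc r) → Bool
  isU x = does (toℕ x Data.Nat.≟ 0)
  isUV : Fin (suc r) → Fin (suc r) → Bool
  isUV x y = does (toℕ x Data.Nat.≟ 0) ∧ does (toℕ y Data.Nat.≟ 1)

rotatedClique : (r : ℕ) → Graph (suc r)
rotatedClique r = record { adj = rotAdj r ; sym = s ; irref = ir }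
  where
  open import Relation.Binary.PropositionalEquality using (refl)
  open import Data.Bool.Properties using (∨-comm)
  ir : ∀ a → rotAdj r a a ≡ false
  ir a with a ≟ a
  ... | yes _ = refl
  ... | no ¬p = Data.Empty.⊥-elim (¬p refl)
    where import Data.Empty
  s : ∀ a b → rotAdj r a b ≡ rotAdj r b a
  s a b with a ≟ b | b ≟ a
  ... | yes _ | yes _ = refl
  ... | yes p | no q = Data.Empty.⊥-elim (q (Relation.Binary.PropositionalEquality.sym p))
    where import Data.Empty
  ... | no q | yes p = Data.Empty.⊥-elim (q (Relation.Binary.PropositionalEquality.sym p))
    where import Data.Empty
  ... | no _ | no _
    rewrite ∨-comm (does (toℕ a Data.Nat.≟ r)) (does (toℕ b Data.Nat.≟ r))
          | ∨-comm (does (toℕ a Data.Nat.≟ 0)) (does (toℕ b Data.Nat.≟ 0))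
          | ∨-comm (does (toℕ a Data.Nat.≟ 0) ∧ does (toℕ b Data.Nat.≟ 1))
                   (does (toℕ b Data.Nat.≟ 0) ∧ does (toℕ a Data.Nat.≟ 1)) = refl

module Submission where

-- Write r = 2d (d ≥ 2) and q = r - 1, so
-- that q is odd and binom(r, 2) = q·d.  The witness is a "block graph": the
-- vertices are cut into blocks of K = r^d vertices; each complete block is a
-- coloured copy of the Hamming graph on words of length d over r symbols
-- (two words adjacent when they differ in one coordinate), the incomplete
-- last block is a monochromatic clique, and there are no edges between blocks.
-- The symbols are Z_q ∪ {∞}; the edge {i, j} of a line (the r words differing
-- only in coordinate k) has centre i + j mod q (2i for {i, ∞}), and the edge
-- gets the colour (centre h, phase k + S_h(a) mod d), where S_h(a) adds up the
-- "radii" |2a_m - h| of the coordinates of an endpoint a.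

open import Data.Nat using (ℕ; NonZero; _*_; _≤_)
open import Relation.Binary.Definitions using (DecidableEquality)
open import Defs using (SatAtMost; rotatedClique)

module Congruence (m : ℕ) .{{_ : NonZero m}} where

  open import Data.Nat
  open import Data.Nat.Properties
  open import Data.Nat.DivMod
  open import Relation.Binary.PropositionalEquality
  open ≡-Reasoning

  infix 4 _≋_
  record _≋_ (x y : ℕ) : Set where
    constructor mk≋
    field un≋ : x % m ≡ y % m
  open _≋_ public

  ≋-refl : ∀ {x} → x ≋ x
  ≋-refl = mk≋ refl

  ≋-sym : ∀ {x y} → x ≋ y → y ≋ x
  ≋-sym (mk≋ p) = mk≋ (sym p)

  ≋-trans : ∀ {x y z} → x ≋ y → y ≋ z → x ≋ z
  ≋-trans (mk≋ p) (mk≋ q) = mk≋ (trans p q)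

  ≡⇒≋ : ∀ {x y} → x ≡ y → x ≋ y
  ≡⇒≋ refl = ≋-refl

  ≋-+ : ∀ {a b c e} → a ≋ b → c ≋ e → a + c ≋ b + e
  ≋-+ {a} {b} {c} {e} (mk≋ p) (mk≋ q) = mk≋ (begin
    (a + c) % m          ≡⟨ %-distribˡ-+ a c m ⟩
    (a % m + c % m) % m  ≡⟨ cong₂ (λ u v → (u + v) % m) p q ⟩
    (b % m + e % m) % m  ≡⟨ %-distribˡ-+ b e m ⟨
    (b + e) % m          ∎)

  ≋-* : ∀ {a b c e} → a ≋ b → c ≋ e → a * c ≋ b * e
  ≋-* {a} {b} {c} {e} (mk≋ p) (mk≋ q) = mk≋ (begin
    (a * c) % m              ≡⟨ %-distribˡ-* a c m ⟩
    (a % m * (c % m)) % m    ≡⟨ cong₂ (λ u v → (u * v) % m) p q ⟩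
    (b % m * (e % m)) % m    ≡⟨ %-distribˡ-* b e m ⟨
    (b * e) % m              ∎)

  %≋ : ∀ x → x % m ≋ x
  %≋ x = mk≋ (m%n%n≡m%n x m)

  multiple≋0 : ∀ k → k * m ≋ 0
  multiple≋0 k = mk≋ (trans (m*n%n≡0 k m) (sym (m*n%n≡0 0 m)))

  m≋0 : m ≋ 0
  m≋0 = ≋-trans (≡⇒≋ (sym (*-identityˡ m))) (multiple≋0 1)

  ≋⇒≡ : ∀ {x y} → x < m → y < m → x ≋ y → x ≡ y
  ≋⇒≡ x<m y<m (mk≋ p) = trans (sym (m<n⇒m%n≡m x<m)) (trans p (m<n⇒m%n≡m y<m))

  %-of-≋ : ∀ {x y} → y < m → x ≋ y → x % m ≡ y
  %-of-≋ y<m (mk≋ p) = trans p (m<n⇒m%n≡m y<m)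

  negate : ℕ → ℕ
  negate z = m ∸ z % m

  +-negate : ∀ z → z + negate z ≋ 0
  +-negate z = ≋-trans (≋-+ (≋-sym (%≋ z)) (≋-refl {negate z}))
                 (≋-trans (≡⇒≋ (m+[n∸m]≡n (<⇒≤ (m%n<n z m)))) m≋0)

  ≋-cancelʳ : ∀ {x y} z → x + z ≋ y + z → x ≋ y
  ≋-cancelʳ {x} {y} z p =
    ≋-trans (≡⇒≋ (sym (+-identityʳ x)))
    (≋-trans (≋-+ (≋-refl {x}) (≋-sym (+-negate z)))
    (≋-trans (≡⇒≋ (sym (+-assoc x z (negate z))))
    (≋-trans (≋-+ p (≋-refl {negate z}))
    (≋-trans (≡⇒≋ (+-assoc y z (negate z)))
    (≋-trans (≋-+ (≋-refl {y}) (+-negate z))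
             (≡⇒≋ (+-identityʳ y)))))))

  cancel-residue : ∀ {x y} z → x < m → y < m → (x + z) % m ≡ (y + z) % m → x ≡ y
  cancel-residue z x<m y<m p = ≋⇒≡ x<m y<m (≋-cancelʳ z (mk≋ p))

  subtractMod : ℕ → ℕ → ℕ
  subtractMod p s = (p + negate s) % m

  subtractMod-< : ∀ p s → subtractMod p s < m
  subtractMod-< p s = m%n<n (p + negate s) m

  subtractMod-+ : ∀ p s → subtractMod p s + s ≋ p
  subtractMod-+ p s =
    ≋-trans (≋-+ (%≋ (p + negate s)) (≋-refl {s}))
    (≋-trans (≡⇒≋ (trans (+-assoc p (negate s) s) (cong (p +_) (+-comm (negate s) s))))
    (≋-trans (≋-+ (≋-refl {p}) (+-negate s)) (≡⇒≋ (+-identityʳ p))))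

-- The one-factorisation of K_{q+1} for odd q = 2d - 1, where d = f + 2.
-- Vertices are the residues 0 … q-1 together with q, which plays the point ∞.
-- The edge {i, j} has centre i + j mod q, and {i, ∞} has centre 2i; each
-- centre class is a perfect matching.  The radius of a vertex i with respect
-- to a centre h is |2i - h| ∈ [0, d) (and 0 for ∞): the two ends of an edge of
-- centre h have the same radius, and different edges of centre h have
-- different radii, which is what makes every line of the Hamming colouring
-- rainbow.
module OneFactorisation (f : ℕ) where

  open import Data.Nat
  open import Data.Nat.Properties
  open import Data.Nat.DivMod
  open import Data.Nat.Tactic.RingSolver using (solve-∀)
  open import Relation.Binary.PropositionalEquality
  open import Relation.Nullary using (Dec; yes; no)
  open import Data.Empty using (⊥-elim)
  open import Data.Sum using (_⊎_; inj₁; inj₂)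
  open import Data.Product using (∃; _×_; _,_)

  -- d = r/2 and q = r - 1 = 2d - 1
  d : ℕ
  d = suc (suc f)

  q : ℕ
  q = suc (suc (suc (f * 2)))

  open Congruence q public

  interchange : ∀ a b c e → (a + b) + (c + e) ≡ (a + c) + (b + e)
  interchange = solve-∀

  d+d≡1+q : d + d ≡ suc q
  d+d≡1+q = twice f
    where
    twice : ∀ g → suc (suc g) + suc (suc g) ≡ suc (suc (suc (suc (g * 2))))
    twice = solve-∀

  d<q : d < q
  d<q = s≤s (s≤s (s≤s (m≤m*n f 2)))

  double-half : ∀ x → (x + x) * d ≋ x
  double-half x = mk≋ (trans (cong (_% q) (expand x f)) ([m+kn]%n≡m%n x x q))
    where
    expand : ∀ x g → (x + x) * suc (suc g) ≡ x + x * suc (suc (suc (g * 2)))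
    expand = solve-∀

  double-injective : ∀ {x y} → x < q → y < q → x + x ≋ y + y → x ≡ y
  double-injective {x} {y} x<q y<q p = ≋⇒≡ x<q y<q
    (≋-trans (≋-sym (double-half x)) (≋-trans (≋-* p (≋-refl {d})) (double-half y)))

  half : ℕ → ℕ
  half z = (z * d) % q

  half-< : ∀ z → half z < q
  half-< z = m%n<n (z * d) q

  half+half : ∀ z → half z + half z ≋ z
  half+half z = ≋-trans (≋-+ (%≋ (z * d)) (%≋ (z * d)))
                  (≋-trans (≡⇒≋ (sym (*-distribʳ-+ d z z))) (double-half z))

  -- the absolute value of a residue: the representative of ±δ lying in [0, d)
  absolute : ℕ → ℕ
  absolute δ with δ <? d
  ... | yes _ = δ
  ... | no _ = q ∸ δ

  absolute-small : ∀ δ → δ < d → absolute δ ≡ δ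
  absolute-small δ δ<d with δ <? d
  ... | yes _ = refl
  ... | no δ≮d = ⊥-elim (δ≮d δ<d)

  both-small : ∀ {x y} → x < d → y < d → x + y < q
  both-small {x} {y} x<d y<d = +-cancelˡ-≤ 1 _ _ (≤-trans (≤-reflexive (sym (+-suc (suc x) y)))
      (≤-trans (+-mono-≤ x<d y<d) (≤-reflexive d+d≡1+q)))

  both-large : ∀ {x y} → d ≤ x → d ≤ y → q < x + y
  both-large d≤x d≤y = ≤-trans (≤-reflexive (sym d+d≡1+q)) (+-mono-≤ d≤x d≤y)

  absolute-< : ∀ δ → δ < q → absolute δ < d
  absolute-< δ δ<q with δ <? d
  ... | yes δ<d = δ<d
  ... | no δ≮d with (q ∸ δ) <? d
  ...   | yes lt = lt
  ...   | no ≮d = ⊥-elim (<-irrefl (sym (m+[n∸m]≡n (<⇒≤ δ<q))) (both-large (≮⇒≥ δ≮d) (≮⇒≥ ≮d)))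

  sum≡q : ∀ {x y} → x < q → y < q → x ≢ 0 → x + y ≋ 0 → x + y ≡ q
  sum≡q {x} {y} x<q y<q x≢0 (mk≋ p) with (x + y) <? q
  ... | yes lt = ⊥-elim (x≢0 (m+n≡0⇒m≡0 x (trans (sym (m<n⇒m%n≡m lt)) p)))
  ... | no ≮q = sym (≤-antisym q≤ (m∸n≡0⇒m≤n (trans (sym (m<n⇒m%n≡m below)) (trans (m≤n⇒[n∸m]%m≡n%m q≤) p))))
    where
    q≤ : q ≤ x + y
    q≤ = ≮⇒≥ ≮q
    below : x + y ∸ q < q
    below = +-cancelʳ-< _ _ q (≤-trans (≤-reflexive (cong suc (m∸n+n≡m q≤))) (+-mono-≤ x<q (<⇒≤ y<q)))

  absolute-complement : ∀ δ δ' → δ + δ' ≡ q → absolute δ ≡ absolute δ'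
  absolute-complement δ δ' s with δ <? d | δ' <? d
  ... | yes a | yes b = ⊥-elim (<-irrefl s (both-small a b))
  ... | yes _ | no _ = sym (trans (cong (_∸ δ') (sym s)) (m+n∸n≡m δ δ'))
  ... | no _ | yes _ = trans (cong (_∸ δ) (sym s)) (m+n∸m≡n δ δ')
  ... | no a | no b = ⊥-elim (<-irrefl (sym s) (both-large (≮⇒≥ a) (≮⇒≥ b)))

  absolute-negate : ∀ δ δ' → δ < q → δ' < q → δ + δ' ≋ 0 → absolute δ ≡ absolute δ'
  absolute-negate δ δ' δ<q δ'<q p with δ ≟ 0
  ... | yes refl = cong absolute (sym (≋⇒≡ δ'<q (s≤s z≤n) p))
  ... | no δ≢0 = absolute-complement δ δ' (sum≡q δ<q δ'<q δ≢0 p)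

  absolute-injective : ∀ δ δ' → δ < q → δ' < q → absolute δ ≡ absolute δ' → δ ≡ δ' ⊎ δ + δ' ≡ q
  absolute-injective δ δ' δ<q δ'<q e with δ <? d | δ' <? d
  ... | yes _ | yes _ = inj₁ e
  ... | yes _ | no _ = inj₂ (trans (cong (_+ δ') e) (m∸n+n≡m (<⇒≤ δ'<q)))
  ... | no _ | yes _ = inj₂ (trans (cong (δ +_) (sym e)) (m+[n∸m]≡n (<⇒≤ δ<q)))
  ... | no _ | no _ = inj₁ (∸-cancelˡ-≡ (<⇒≤ δ<q) (<⇒≤ δ'<q) e)

  absolute≡0 : ∀ δ → δ < q → absolute δ ≡ 0 → δ ≡ 0
  absolute≡0 δ δ<q e with δ <? d
  ... | yes _ = e
  ... | no _ = ⊥-elim (<⇒≱ δ<q (m∸n≡0⇒m≤n e))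

  centre : ℕ → ℕ → ℕ
  centre i j with i ≟ q | j ≟ q
  ... | yes _ | _ = (j + j) % q
  ... | no _ | yes _ = (i + i) % q
  ... | no _ | no _ = (i + j) % q

  centre-∞ˡ : ∀ j → centre q j ≡ (j + j) % q
  centre-∞ˡ j with q ≟ q
  ... | yes _ = refl
  ... | no q≢q = ⊥-elim (q≢q refl)

  centre-∞ʳ : ∀ {i} → i ≢ q → centre i q ≡ (i + i) % q
  centre-∞ʳ {i} i≢q with i ≟ q | q ≟ q
  ... | yes i≡q | _ = ⊥-elim (i≢q i≡q)
  ... | no _ | yes _ = refl
  ... | no _ | no q≢q = ⊥-elim (q≢q refl)

  centre-finite : ∀ {i j} → i ≢ q → j ≢ q → centre i j ≡ (i + j) % q
  centre-finite {i} {j} i≢q j≢q with i ≟ q | j ≟ q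
  ... | yes i≡q | _ = ⊥-elim (i≢q i≡q)
  ... | no _ | yes j≡q = ⊥-elim (j≢q j≡q)
  ... | no _ | no _ = refl

  centre-< : ∀ i j → centre i j < q
  centre-< i j with i ≟ q | j ≟ q
  ... | yes _ | _ = m%n<n (j + j) q
  ... | no _ | yes _ = m%n<n (i + i) q
  ... | no _ | no _ = m%n<n (i + j) q

  centre-sym : ∀ i j → centre i j ≡ centre j i
  centre-sym i j with i ≟ q | j ≟ q
  ... | yes refl | yes refl = refl
  ... | yes refl | no _ = refl
  ... | no _ | yes refl = refl
  ... | no _ | no _ = cong (_% q) (+-comm i j)

  -- deciding whether a vertex is ∞, without unfolding centre or radius
  ∞? : ∀ i → i ≡ q ⊎ i ≢ q
  ∞? i with i ≟ q
  ... | yes i≡q = inj₁ i≡q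
  ... | no i≢q = inj₂ i≢q

  centre-injective : ∀ {i j j'} → i ≤ q → j ≤ q → j' ≤ q → i ≢ j → i ≢ j' →
                     centre i j ≡ centre i j' → j ≡ j'
  centre-injective {i} {j} {j'} i≤q j≤q j'≤q i≢j i≢j' e with ∞? i | ∞? j | ∞? j'
  ... | inj₁ refl | inj₁ refl | _ = ⊥-elim (i≢j refl)
  ... | inj₁ refl | inj₂ _ | inj₁ refl = ⊥-elim (i≢j' refl)
  ... | inj₁ refl | inj₂ j≢q | inj₂ j'≢q = double-injective (≤∧≢⇒< j≤q j≢q) (≤∧≢⇒< j'≤q j'≢q)
          (mk≋ (trans (sym (centre-∞ˡ j)) (trans e (centre-∞ˡ j'))))
  ... | inj₂ _ | inj₁ refl | inj₁ refl = refl
  ... | inj₂ i≢q | inj₁ refl | inj₂ j'≢q = ⊥-elim (i≢j' (≋⇒≡ (≤∧≢⇒< i≤q i≢q) (≤∧≢⇒< j'≤q j'≢q)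
          (≋-cancelʳ i (mk≋ (trans (sym (centre-∞ʳ i≢q))
            (trans e (trans (centre-finite i≢q j'≢q) (cong (_% q) (+-comm i j')))))))))
  ... | inj₂ i≢q | inj₂ j≢q | inj₁ refl = ⊥-elim (i≢j (≋⇒≡ (≤∧≢⇒< i≤q i≢q) (≤∧≢⇒< j≤q j≢q)
          (≋-cancelʳ i (mk≋ (trans (sym (centre-∞ʳ i≢q))
            (trans (sym e) (trans (centre-finite i≢q j≢q) (cong (_% q) (+-comm i j)))))))))
  ... | inj₂ i≢q | inj₂ j≢q | inj₂ j'≢q = ≋⇒≡ (≤∧≢⇒< j≤q j≢q) (≤∧≢⇒< j'≤q j'≢q)
          (≋-cancelʳ i (mk≋ (trans (cong (_% q) (+-comm j i)) (trans (sym (centre-finite i≢q j≢q))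
             (trans e (trans (centre-finite i≢q j'≢q) (cong (_% q) (+-comm i j'))))))))

  partner : ∀ {h i} → h < q → i ≤ q → ∃ λ j → j ≤ q × j ≢ i × centre i j ≡ h
  partner {h} {i} h<q i≤q with ∞? i
  ... | inj₁ refl = half h , <⇒≤ (half-< h) , <⇒≢ (half-< h) ,
                   trans (centre-∞ˡ (half h)) (%-of-≋ h<q (half+half h))
  ... | inj₂ i≢q = pick (j₀ ≟ i)
    where
    j₀ = subtractMod h i
    i+j₀ : i + j₀ ≋ h
    i+j₀ = ≋-trans (≡⇒≋ (+-comm i j₀)) (subtractMod-+ h i)
    pick : Dec (j₀ ≡ i) → ∃ λ j → j ≤ q × j ≢ i × centre i j ≡ h
    pick (yes j₀≡i) = q , ≤-refl , (λ q≡i → i≢q (sym q≡i)) ,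
      trans (centre-∞ʳ i≢q) (%-of-≋ h<q (≋-trans (≡⇒≋ (cong (i +_) (sym j₀≡i))) i+j₀))
    pick (no j₀≢i) = j₀ , <⇒≤ (subtractMod-< h i) , j₀≢i ,
      trans (centre-finite i≢q (<⇒≢ (subtractMod-< h i))) (%-of-≋ h<q i+j₀)

  twiceMinus : ℕ → ℕ → ℕ
  twiceMinus h i = (i + i + negate h) % q

  twiceMinus-< : ∀ h i → twiceMinus h i < q
  twiceMinus-< h i = m%n<n (i + i + negate h) q

  twiceMinus+h : ∀ h i → twiceMinus h i + h ≋ i + i
  twiceMinus+h h i = ≋-trans (≋-+ (%≋ (i + i + negate h)) (≋-refl {h}))
    (≋-trans (≡⇒≋ (trans (+-assoc (i + i) (negate h) h) (cong (i + i +_) (+-comm (negate h) h))))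
    (≋-trans (≋-+ (≋-refl {i + i}) (+-negate h)) (≡⇒≋ (+-identityʳ (i + i)))))

  twiceMinus≡0 : ∀ h i → h ≋ i + i → twiceMinus h i ≡ 0
  twiceMinus≡0 h i p = ≋⇒≡ (twiceMinus-< h i) (s≤s z≤n)
    (≋-cancelʳ h (≋-trans (twiceMinus+h h i) (≋-sym p)))

  radius : ℕ → ℕ → ℕ
  radius h i with i ≟ q
  ... | yes _ = 0
  ... | no _ = absolute (twiceMinus h i)

  radius-∞ : ∀ h → radius h q ≡ 0
  radius-∞ h with q ≟ q
  ... | yes _ = refl
  ... | no q≢q = ⊥-elim (q≢q refl)

  radius-finite : ∀ h {i} → i ≢ q → radius h i ≡ absolute (twiceMinus h i)
  radius-finite h {i} i≢q with i ≟ q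
  ... | yes i≡q = ⊥-elim (i≢q i≡q)
  ... | no _ = refl

  radius-< : ∀ h i → radius h i < d
  radius-< h i with i ≟ q
  ... | yes _ = s≤s z≤n
  ... | no _ = absolute-< (twiceMinus h i) (twiceMinus-< h i)

  radius-fixed : ∀ h {i} → i ≢ q → h ≋ i + i → radius h i ≡ 0
  radius-fixed h {i} i≢q p = trans (radius-finite h i≢q)
    (trans (cong absolute (twiceMinus≡0 h i p)) (absolute-small 0 (s≤s z≤n)))

  radius-edge : ∀ {i j} → i ≢ j → radius (centre i j) i ≡ radius (centre i j) j
  radius-edge {i} {j} i≢j with ∞? i | ∞? j
  ... | inj₁ refl | inj₁ refl = ⊥-elim (i≢j refl)
  ... | inj₁ refl | inj₂ j≢q = trans (radius-∞ h)
          (sym (radius-fixed h j≢q (≋-trans (≡⇒≋ (centre-∞ˡ j)) (%≋ (j + j)))))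
    where h = centre q j
  ... | inj₂ i≢q | inj₁ refl = trans (radius-fixed h i≢q (≋-trans (≡⇒≋ (centre-∞ʳ i≢q)) (%≋ (i + i))))
          (sym (radius-∞ h))
    where h = centre i q
  ... | inj₂ i≢q | inj₂ j≢q = trans (radius-finite h i≢q)
          (trans (absolute-negate _ _ (twiceMinus-< h i) (twiceMinus-< h j) opposite)
                 (sym (radius-finite h j≢q)))
    where
    h = centre i j
    h≋ : h ≋ i + j
    h≋ = ≋-trans (≡⇒≋ (centre-finite i≢q j≢q)) (%≋ (i + j))
    opposite : twiceMinus h i + twiceMinus h j ≋ 0
    opposite = ≋-cancelʳ (h + h)
      (≋-trans (≡⇒≋ (interchange (twiceMinus h i) (twiceMinus h j) h h))
      (≋-trans (≋-+ (twiceMinus+h h i) (twiceMinus+h h j))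
      (≋-trans (≡⇒≋ (interchange i i j j)) (≋-sym (≋-+ h≋ h≋)))))

  radius-injective : ∀ {h i i'} → h < q → i ≤ q → i' ≤ q → radius h i ≡ radius h i' →
                     i ≡ i' ⊎ centre i i' ≡ h
  radius-injective {h} {i} {i'} h<q i≤q i'≤q e with ∞? i | ∞? i'
  ... | inj₁ refl | inj₁ refl = inj₁ refl
  ... | inj₁ refl | inj₂ i'≢q = inj₂ (trans (centre-∞ˡ i') (%-of-≋ h<q (≋-sym (fixed i'≢q (sym e')))))
    where e' = trans (sym e) (radius-∞ h)
          fixed : ∀ {x} → x ≢ q → 0 ≡ radius h x → h ≋ x + x
          fixed {x} x≢q r0 = ≋-trans (≡⇒≋ (cong (_+ h) (sym (absolute≡0 _ (twiceMinus-< h x)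
                               (trans (sym (radius-finite h x≢q)) (sym r0)))))) (twiceMinus+h h x)
  ... | inj₂ i≢q | inj₁ refl = inj₂ (trans (centre-∞ʳ i≢q) (%-of-≋ h<q (≋-sym (fixed i≢q (sym e')))))
    where e' = trans e (radius-∞ h)
          fixed : ∀ {x} → x ≢ q → 0 ≡ radius h x → h ≋ x + x
          fixed {x} x≢q r0 = ≋-trans (≡⇒≋ (cong (_+ h) (sym (absolute≡0 _ (twiceMinus-< h x)
                               (trans (sym (radius-finite h x≢q)) (sym r0)))))) (twiceMinus+h h x)
  ... | inj₂ i≢q | inj₂ i'≢q with absolute-injective _ _ (twiceMinus-< h i) (twiceMinus-< h i')
                                (trans (sym (radius-finite h i≢q)) (trans e (radius-finite h i'≢q)))
  ...   | inj₁ same = inj₁ (double-injective (≤∧≢⇒< i≤q i≢q) (≤∧≢⇒< i'≤q i'≢q)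
             (≋-trans (≋-sym (twiceMinus+h h i)) (≋-trans (≡⇒≋ (cong (_+ h) same)) (twiceMinus+h h i'))))
  ...   | inj₂ sumq = inj₂ (trans (centre-finite i≢q i'≢q) (double-injective (m%n<n (i + i') q) h<q doubled))
    where
    doubled : (i + i') % q + (i + i') % q ≋ h + h
    doubled = ≋-trans (≋-+ (%≋ (i + i')) (%≋ (i + i')))
      (≋-trans (≡⇒≋ (interchange i i' i i'))
      (≋-trans (≋-+ (≋-sym (twiceMinus+h h i)) (≋-sym (twiceMinus+h h i')))
      (≋-trans (≡⇒≋ (interchange (twiceMinus h i) h (twiceMinus h i') h))
      (≋-trans (≋-+ (≡⇒≋ sumq) (≋-refl {h + h})) (≋-+ m≋0 (≋-refl {h + h}))))))

  radius-surjective : ∀ {h s} → h < q → s < d → ∃ λ i → i ≤ q × radius h i ≡ s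
  radius-surjective {h} {s} h<q s<d = i , <⇒≤ (half-< (h + s)) ,
      trans (radius-finite h (<⇒≢ (half-< (h + s)))) (trans (cong absolute twice-i) (absolute-small s s<d))
    where
    i = half (h + s)
    twice-i : twiceMinus h i ≡ s
    twice-i = %-of-≋ (<-trans s<d d<q) (≋-trans (≋-+ (half+half (h + s)) (≋-refl {negate h}))
      (≋-trans (≡⇒≋ (rotate h s (negate h))) (≋-trans (≋-+ (≋-refl {s}) (+-negate h)) (≡⇒≋ (+-identityʳ s)))))
      where
      rotate : ∀ h s n → h + s + n ≡ s + (h + n)
      rotate = solve-∀

module OneCoordinateDifference {A : Set} (_≟A_ : DecidableEquality A) where

  open import Data.Nat using (ℕ; _+_)
  open import Data.Nat.Properties using (+-assoc; +-comm)
  open import Data.Fin using (Fin; zero; suc)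
  open import Data.Fin.Properties using (suc-injective) renaming (_≟_ to _≟F_)
  open import Data.Vec using (Vec; []; _∷_; lookup; _[_]≔_)
  open import Data.Vec.Properties using (≡-dec; lookup∘update; lookup∘update′; []≔-lookup;
                                         tabulate∘lookup; tabulate-cong)
  open import Data.Maybe using (Maybe; just; nothing)
  import Data.Maybe as Maybe
  open import Data.Product using (_×_; _,_)
  open import Relation.Binary.PropositionalEquality
  open import Relation.Nullary using (yes; no)
  open import Data.Empty using (⊥-elim)

  record DiffAt {n} (a b : Vec A n) (k : Fin n) : Set where
    constructor _,_
    field
      differs : lookup a k ≢ lookup b k
      agrees : ∀ m → m ≢ k → lookup a m ≡ lookup b m
  open DiffAt public

  differingCoordinate : ∀ {n} → Vec A n → Vec A n → Maybe (Fin n)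
  differingCoordinate [] [] = nothing
  differingCoordinate (x ∷ xs) (y ∷ ys) with x ≟A y
  ... | yes _ = Maybe.map suc (differingCoordinate xs ys)
  ... | no _ with ≡-dec _≟A_ xs ys
  ...   | yes _ = just zero
  ...   | no _ = nothing

  vector-ext : ∀ {n} {a b : Vec A n} → (∀ m → lookup a m ≡ lookup b m) → a ≡ b
  vector-ext {a = a} {b} p = trans (sym (tabulate∘lookup a)) (trans (tabulate-cong p) (tabulate∘lookup b))

  differing-sound : ∀ {n} (a b : Vec A n) {k} → differingCoordinate a b ≡ just k → DiffAt a b k
  differing-sound [] [] ()
  differing-sound (x ∷ xs) (y ∷ ys) e with x ≟A y
  differing-sound (x ∷ xs) (y ∷ ys) e | yes x≡y with differingCoordinate xs ys in eq
  differing-sound (x ∷ xs) (y ∷ ys) refl | yes x≡y | just k =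
    differs (differing-sound xs ys eq) ,
    λ { zero _ → x≡y ; (suc m) m≢ → agrees (differing-sound xs ys eq) m (λ e → m≢ (cong suc e)) }
  differing-sound (x ∷ xs) (y ∷ ys) () | yes x≡y | nothing
  differing-sound (x ∷ xs) (y ∷ ys) e | no x≢y with ≡-dec _≟A_ xs ys
  differing-sound (x ∷ xs) (y ∷ ys) refl | no x≢y | yes xs≡ys =
    x≢y , λ { zero z≢ → ⊥-elim (z≢ refl) ; (suc m) _ → cong (λ v → lookup v m) xs≡ys }
  differing-sound (x ∷ xs) (y ∷ ys) () | no x≢y | no _

  differing-complete : ∀ {n} (a b : Vec A n) {k} → DiffAt a b k → differingCoordinate a b ≡ just k
  differing-complete [] [] {()} _
  differing-complete (x ∷ xs) (y ∷ ys) {k} (ne , eqs) with x ≟A y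
  differing-complete (x ∷ xs) (y ∷ ys) {zero} (ne , eqs) | yes x≡y = ⊥-elim (ne x≡y)
  differing-complete (x ∷ xs) (y ∷ ys) {suc k} (ne , eqs) | yes x≡y =
    cong (Maybe.map suc) (differing-complete xs ys (ne , λ m m≢ → eqs (suc m) (λ e → m≢ (suc-injective e))))
  differing-complete (x ∷ xs) (y ∷ ys) {suc k} (ne , eqs) | no x≢y = ⊥-elim (x≢y (eqs zero (λ ())))
  differing-complete (x ∷ xs) (y ∷ ys) {zero} (ne , eqs) | no x≢y with ≡-dec _≟A_ xs ys
  ... | yes _ = refl
  ... | no xs≢ys = ⊥-elim (xs≢ys (vector-ext (λ m → eqs (suc m) (λ ()))))

  DiffAt-sym : ∀ {n} {a b : Vec A n} {k} → DiffAt a b k → DiffAt b a k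
  DiffAt-sym (ne , eqs) = (λ e → ne (sym e)) , λ m m≢ → sym (eqs m m≢)

  differing-refl : ∀ {n} (a : Vec A n) → differingCoordinate a a ≡ nothing
  differing-refl a with differingCoordinate a a in e
  ... | nothing = refl
  ... | just k = ⊥-elim (differs (differing-sound a a e) refl)

  -- three vectors pairwise differing in one coordinate all differ in the same
  -- one: the cliques of a Hamming graph are contained in lines
  triangle-direction : ∀ {n} {a b c : Vec A n} {k₁ k₂ k₃} →
                       DiffAt a b k₁ → DiffAt b c k₂ → DiffAt a c k₃ → k₁ ≡ k₂ × k₁ ≡ k₃
  triangle-direction {k₁ = k₁} {k₂} {k₃} (n₁ , e₁) (n₂ , e₂) (n₃ , e₃) = k₁≡k₂ , k₁≡k₃
    where
    k₁≡k₃-if : k₁ ≢ k₂ → k₁ ≡ k₃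
    k₁≡k₃-if k₁≢k₂ with k₁ ≟F k₃
    ... | yes p = p
    ... | no k₁≢k₃ = ⊥-elim (n₁ (trans (e₃ k₁ k₁≢k₃) (sym (e₂ k₁ k₁≢k₂))))
    k₂≡k₃-if : k₁ ≢ k₂ → k₂ ≡ k₃
    k₂≡k₃-if k₁≢k₂ with k₂ ≟F k₃
    ... | yes p = p
    ... | no k₂≢k₃ = ⊥-elim (n₂ (trans (sym (e₁ k₂ (λ e → k₁≢k₂ (sym e)))) (e₃ k₂ k₂≢k₃)))
    k₁≡k₂ : k₁ ≡ k₂
    k₁≡k₂ with k₁ ≟F k₂
    ... | yes p = p
    ... | no k₁≢k₂ = ⊥-elim (k₁≢k₂ (trans (k₁≡k₃-if k₁≢k₂) (sym (k₂≡k₃-if k₁≢k₂))))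
    k₁≡k₃ : k₁ ≡ k₃
    k₁≡k₃ with k₁ ≟F k₃
    ... | yes p = p
    ... | no k₁≢k₃ = ⊥-elim (n₃ (trans (e₁ k₃ (λ e → k₁≢k₃ (sym e)))
                                       (e₂ k₃ (λ e → k₁≢k₃ (trans k₁≡k₂ (sym e))))))

  update-DiffAt : ∀ {n} (v : Vec A n) k {i j} → i ≢ j → DiffAt (v [ k ]≔ i) (v [ k ]≔ j) k
  update-DiffAt v k {i} {j} i≢j =
    (λ e → i≢j (trans (sym (lookup∘update k v i)) (trans e (lookup∘update k v j)))) ,
    λ m m≢k → trans (lookup∘update′ m≢k v i) (sym (lookup∘update′ m≢k v j))

  DiffAt⇒update : ∀ {n} {a b : Vec A n} {k} → DiffAt a b k → b ≡ a [ k ]≔ lookup b k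
  DiffAt⇒update {a = a} {b} {k} (ne , eqs) = vector-ext pointwise
    where
    pointwise : ∀ m → lookup b m ≡ lookup (a [ k ]≔ lookup b k) m
    pointwise m with k ≟F m
    ... | yes refl = sym (lookup∘update k a (lookup b k))
    ... | no k≢m = trans (sym (eqs m (λ e → k≢m (sym e))))
                         (sym (lookup∘update′ (λ e → k≢m (sym e)) a (lookup b k)))

  weight : (A → ℕ) → ∀ {n} → Vec A n → ℕ
  weight g [] = 0
  weight g (x ∷ xs) = g x + weight g xs

  weightExcept : (A → ℕ) → ∀ {n} → Vec A n → Fin n → ℕ
  weightExcept g (x ∷ xs) zero = weight g xs
  weightExcept g (x ∷ xs) (suc k) = g x + weightExcept g xs k

  weight-update : ∀ g {n} (v : Vec A n) k x → weight g (v [ k ]≔ x) ≡ g x + weightExcept g v k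
  weight-update g (y ∷ v) zero x = refl
  weight-update g (y ∷ v) (suc k) x = trans (cong (g y +_) (weight-update g v k x))
    (trans (sym (+-assoc (g y) (g x) _)) (trans (cong (_+ weightExcept g v k) (+-comm (g y) (g x)))
           (+-assoc (g x) (g y) _)))

  weight-split : ∀ g {n} (v : Vec A n) k → weight g v ≡ g (lookup v k) + weightExcept g v k
  weight-split g v k = trans (cong (weight g) (sym ([]≔-lookup v k))) (weight-update g v k (lookup v k))

-- S_h takes the same value at both
-- ends of the edge, so the colour is well defined.
module HammingColouring (f : ℕ) where

  open import Data.Nat
  open import Data.Nat.Properties
  open import Data.Nat.DivMod
  open import Data.Nat.Tactic.RingSolver using (solve-∀)
  open import Data.Fin using (Fin; suc; toℕ; fromℕ<; combine)
  open import Data.Fin.Properties using (toℕ-injective; toℕ-fromℕ<; combine-injective; combine-surjective; toℕ<n)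
                                  renaming (_≟_ to _≟F_)
  open import Data.Vec using (Vec; lookup; _[_]≔_)
  open import Data.Vec.Properties using (lookup∘update)
  open import Data.Maybe using (Maybe; just; nothing)
  import Data.Maybe as Maybe
  open import Data.Product using (∃; ∃₂; _×_; _,_)
  open import Data.Sum using (_⊎_; inj₁; inj₂)
  open import Relation.Binary.PropositionalEquality
  open import Relation.Nullary using (yes; no)
  open import Data.Empty using (⊥-elim)

  open OneFactorisation f public
  module Phase = Congruence d

  r : ℕ
  r = suc q

  open OneCoordinateDifference (_≟F_ {r}) public

  Word : Set
  Word = Vec (Fin r) d

  Colour : Set
  Colour = Fin (q * d)

  wordCount : ℕ
  wordCount = r ^ d

  toℕ≢ : ∀ {n} {x y : Fin n} → x ≢ y → toℕ x ≢ toℕ y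
  toℕ≢ x≢y e = x≢y (toℕ-injective e)

  toℕ≤q : ∀ (x : Fin r) → toℕ x ≤ q
  toℕ≤q x = s≤s⁻¹ (toℕ<n x)

  vertex : ∀ {x} → x ≤ q → Fin r
  vertex x≤q = fromℕ< (s≤s x≤q)

  toℕ-vertex : ∀ {x} (x≤q : x ≤ q) → toℕ (vertex x≤q) ≡ x
  toℕ-vertex x≤q = toℕ-fromℕ< (s≤s x≤q)

  colour : ℕ → ℕ → Colour
  colour h p = combine (fromℕ< (m%n<n h q)) (fromℕ< (m%n<n p d))

  colour-cong : ∀ {h h' p p'} → h ≡ h' → p Phase.≋ p' → colour h p ≡ colour h' p'
  colour-cong {h} {p = p} {p'} refl (Phase.mk≋ p≋p') = cong (combine (fromℕ< (m%n<n h q)))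
    (toℕ-injective (trans (toℕ-fromℕ< (m%n<n p d)) (trans p≋p' (sym (toℕ-fromℕ< (m%n<n p' d))))))

  colour-injective : ∀ {h h' p p'} → h < q → h' < q → colour h p ≡ colour h' p' → h ≡ h' × p Phase.≋ p'
  colour-injective {h} {h'} {p} {p'} h<q h'<q e with combine-injective _ _ _ _ e
  ... | same-h , same-p =
    trans (sym (m<n⇒m%n≡m h<q)) (trans (sym (toℕ-fromℕ< (m%n<n h q))) (trans (cong toℕ same-h)
      (trans (toℕ-fromℕ< (m%n<n h' q)) (m<n⇒m%n≡m h'<q)))) ,
    Phase.mk≋ (trans (sym (toℕ-fromℕ< (m%n<n p d))) (trans (cong toℕ same-p) (toℕ-fromℕ< (m%n<n p' d))))

  colour-surjective : ∀ c → ∃₂ λ h p → h < q × colour h p ≡ c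
  colour-surjective c with combine-surjective c
  ... | hF , pF , e = toℕ hF , toℕ pF , toℕ<n hF ,
      trans (cong₂ combine (canonical hF) (canonical pF)) e
    where
    canonical : ∀ {m} .{{_ : NonZero m}} (x : Fin m) → fromℕ< (m%n<n (toℕ x) m) ≡ x
    canonical {m} x = toℕ-injective (trans (toℕ-fromℕ< (m%n<n (toℕ x) m)) (m<n⇒m%n≡m (toℕ<n x)))

  radiusOf : ℕ → Fin r → ℕ
  radiusOf h x = radius h (toℕ x)

  radiusSum : ℕ → Word → ℕ
  radiusSum h a = weight (radiusOf h) a

  edgeCentre : Word → Word → Fin d → ℕ
  edgeCentre a b k = centre (toℕ (lookup a k)) (toℕ (lookup b k))

  edgePhase : Word → Word → Fin d → ℕ
  edgePhase a b k = toℕ k + radiusSum (edgeCentre a b k) a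

  radiusSum-edge : ∀ {a b k} → DiffAt a b k → radiusSum (edgeCentre a b k) a ≡ radiusSum (edgeCentre a b k) b
  radiusSum-edge {a} {b} {k} diff = begin
      radiusSum h a                                   ≡⟨ weight-split (radiusOf h) a k ⟩
      radiusOf h (lookup a k) + weightExcept (radiusOf h) a k
                                                      ≡⟨ cong (_+ weightExcept (radiusOf h) a k)
                                                              (radius-edge (toℕ≢ (differs diff))) ⟩
      radiusOf h (lookup b k) + weightExcept (radiusOf h) a k
                                                      ≡⟨ weight-update (radiusOf h) a k (lookup b k) ⟨
      radiusSum h (a [ k ]≔ lookup b k)               ≡⟨ cong (radiusSum h) (DiffAt⇒update diff) ⟨
      radiusSum h b                                   ∎
    where
    open ≡-Reasoning
    h = edgeCentre a b k

  -- the colour of the edge ab in direction k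
  -- (opaque, so that goals mentioning edge colours stay small)
  opaque
    colourOf : Word → Word → Fin d → Colour
    colourOf a b k = colour (edgeCentre a b k) (edgePhase a b k)

    colourOf-unfold : ∀ a b k → colourOf a b k ≡ colour (edgeCentre a b k) (edgePhase a b k)
    colourOf-unfold a b k = refl

  colourOf-sym : ∀ {a b k} → DiffAt a b k → colourOf a b k ≡ colourOf b a k
  colourOf-sym {a} {b} {k} diff = trans (colourOf-unfold a b k) (trans (colour-cong same-centre
      (Phase.≡⇒≋ (cong (toℕ k +_) (trans (radiusSum-edge diff) (cong (λ h → radiusSum h b) same-centre)))))
      (sym (colourOf-unfold b a k)))
    where
    same-centre : edgeCentre a b k ≡ edgeCentre b a k
    same-centre = centre-sym (toℕ (lookup a k)) (toℕ (lookup b k))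

  colourOf-injective : ∀ {a b k a' b' k'} → colourOf a b k ≡ colourOf a' b' k' →
                       edgeCentre a b k ≡ edgeCentre a' b' k' × edgePhase a b k Phase.≋ edgePhase a' b' k'
  colourOf-injective {a} {b} {k} {a'} {b'} {k'} e =
    colour-injective (centre-< (toℕ (lookup a k)) (toℕ (lookup b k))) (centre-< (toℕ (lookup a' k')) (toℕ (lookup b' k')))
      (trans (sym (colourOf-unfold a b k)) (trans e (colourOf-unfold a' b' k')))

  opaque
    hammingColour : Word → Word → Maybe Colour
    hammingColour a b = Maybe.map (colourOf a b) (differingCoordinate a b)

    hammingColour-sym : ∀ a b → hammingColour a b ≡ hammingColour b a
    hammingColour-sym a b with differingCoordinate a b in e₁ | differingCoordinate b a in e₂
    ... | nothing | nothing = refl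
    ... | just k | just k' with trans (sym (differing-complete b a (DiffAt-sym (differing-sound a b e₁)))) e₂
    ...   | refl = cong just (colourOf-sym (differing-sound a b e₁))
    hammingColour-sym a b | just k | nothing
      with trans (sym (differing-complete b a (DiffAt-sym (differing-sound a b e₁)))) e₂
    ... | ()
    hammingColour-sym a b | nothing | just k
      with trans (sym (differing-complete a b (DiffAt-sym (differing-sound b a e₂)))) e₁
    ... | ()

    hammingColour-refl : ∀ a → hammingColour a a ≡ nothing
    hammingColour-refl a rewrite differing-refl a = refl

    hammingColour-edge : ∀ {a b k} → DiffAt a b k → hammingColour a b ≡ just (colourOf a b k)
    hammingColour-edge {a} {b} diff rewrite differing-complete a b diff = refl

    hammingColour-inv : ∀ {a b c} → hammingColour a b ≡ just c → ∃ λ k → DiffAt a b k × colourOf a b k ≡ c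
    hammingColour-inv {a} {b} e with differingCoordinate a b in e₁
    hammingColour-inv {a} {b} refl | just k = k , differing-sound a b e₁ , refl

  onLine : Word → Fin d → Fin r → Word
  onLine v k i = v [ k ]≔ i

  edgeCentre-line : ∀ v k i j → edgeCentre (onLine v k i) (onLine v k j) k ≡ centre (toℕ i) (toℕ j)
  edgeCentre-line v k i j = cong₂ (λ x y → centre (toℕ x) (toℕ y)) (lookup∘update k v i) (lookup∘update k v j)

  edgePhase-line : ∀ v k i j → let h = centre (toℕ i) (toℕ j) in
                   edgePhase (onLine v k i) (onLine v k j) k ≡ radius h (toℕ i) + (toℕ k + weightExcept (radiusOf h) v k)
  edgePhase-line v k i j = trans (cong (λ h → toℕ k + radiusSum h (onLine v k i)) (edgeCentre-line v k i j))
    (trans (cong (toℕ k +_) (weight-update (radiusOf h) v k i)) (swap (toℕ k) (radius h (toℕ i)) _))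
    where
    h = centre (toℕ i) (toℕ j)
    swap : ∀ a b c → a + (b + c) ≡ b + (a + c)
    swap = solve-∀

  line-rainbow : ∀ v k {i j i' j'} → i ≢ j → i' ≢ j' →
                 colourOf (onLine v k i) (onLine v k j) k ≡ colourOf (onLine v k i') (onLine v k j') k →
                 (i ≡ i' × j ≡ j') ⊎ (i ≡ j' × j ≡ i')
  line-rainbow v k {i} {j} {i'} {j'} i≢j i'≢j' e
    with colourOf-injective {onLine v k i} {onLine v k j} {k} {onLine v k i'} {onLine v k j'} {k} e
  ... | same-centre , same-phase = same-edge
    where
    h = centre (toℕ i) (toℕ j)
    h≡h' : h ≡ centre (toℕ i') (toℕ j')
    h≡h' = trans (sym (edgeCentre-line v k i j)) (trans same-centre (edgeCentre-line v k i' j'))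
    R = toℕ k + weightExcept (radiusOf h) v k
    phase' : edgePhase (onLine v k i') (onLine v k j') k ≡ radius h (toℕ i') + R
    phase' = trans (edgePhase-line v k i' j')
      (cong (λ h' → radius h' (toℕ i') + (toℕ k + weightExcept (radiusOf h') v k)) (sym h≡h'))
    same-radius : radius h (toℕ i) ≡ radius h (toℕ i')
    same-radius = Phase.≋⇒≡ (radius-< h (toℕ i)) (radius-< h (toℕ i')) (Phase.≋-cancelʳ R
      (Phase.≋-trans (Phase.≡⇒≋ (sym (edgePhase-line v k i j))) (Phase.≋-trans same-phase (Phase.≡⇒≋ phase'))))
    same-edge : (i ≡ i' × j ≡ j') ⊎ (i ≡ j' × j ≡ i')
    same-edge with i ≟F i'
    ... | yes refl = inj₁ (refl , toℕ-injective (centre-injective (toℕ≤q i) (toℕ≤q j) (toℕ≤q j')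
                                                   (toℕ≢ i≢j) (toℕ≢ i'≢j') h≡h'))
    ... | no i≢i' with radius-injective (centre-< (toℕ i) (toℕ j)) (toℕ≤q i) (toℕ≤q i') same-radius
    ...   | inj₁ e' = ⊥-elim (i≢i' (toℕ-injective e'))
    ...   | inj₂ c' = inj₂ (toℕ-injective (sym j'≡i) , toℕ-injective (sym i'≡j))
      where
      i'≡j : toℕ i' ≡ toℕ j
      i'≡j = centre-injective (toℕ≤q i) (toℕ≤q i') (toℕ≤q j) (toℕ≢ i≢i') (toℕ≢ i≢j) c'
      j'≡i : toℕ j' ≡ toℕ i
      j'≡i = centre-injective (toℕ≤q i') (toℕ≤q j') (toℕ≤q i) (toℕ≢ i'≢j') (λ e → i≢i' (toℕ-injective (sym e)))
               (trans (sym h≡h') (trans (sym c') (centre-sym (toℕ i) (toℕ i'))))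

  same-colour-same-direction : ∀ {a b b' k k'} → colourOf a b k ≡ colourOf a b' k' → k ≡ k'
  same-colour-same-direction {a} {b} {b'} {k} {k'} e with colourOf-injective {a} {b} {k} {a} {b'} {k'} e
  ... | same-centre , same-phase = toℕ-injective (Phase.cancel-residue (radiusSum (edgeCentre a b k) a)
        (toℕ<n k) (toℕ<n k')
        (trans (Phase.un≋ same-phase) (cong (λ h → (toℕ k' + radiusSum h a) % d) (sym same-centre))))

  -- every line uses every colour (it has binom(q+1, 2) = q·d edges)
  line-has-every-colour : ∀ v k c → ∃₂ λ i j → i ≢ j × colourOf (onLine v k i) (onLine v k j) k ≡ c
  line-has-every-colour v k c with colour-surjective c
  ... | h , p , h<q , refl
    with radius-surjective {s = Phase.subtractMod p (toℕ k + weightExcept (radiusOf h) v k)} h<q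
                           (Phase.subtractMod-< p (toℕ k + weightExcept (radiusOf h) v k))
  ...   | i₀ , i₀≤q , radius-i₀ with partner h<q i₀≤q
  ...     | j₀ , j₀≤q , j₀≢i₀ , centre-i₀j₀ = i , j , i≢j ,
      trans (colourOf-unfold (onLine v k i) (onLine v k j) k) (colour-cong centre-ij' phase-ij)
    where
    i = vertex i₀≤q
    j = vertex j₀≤q
    R = toℕ k + weightExcept (radiusOf h) v k
    i≢j : i ≢ j
    i≢j e = j₀≢i₀ (sym (trans (sym (toℕ-vertex i₀≤q)) (trans (cong toℕ e) (toℕ-vertex j₀≤q))))
    centre-ij : centre (toℕ i) (toℕ j) ≡ h
    centre-ij = trans (cong₂ centre (toℕ-vertex i₀≤q) (toℕ-vertex j₀≤q)) centre-i₀j₀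
    centre-ij' : edgeCentre (onLine v k i) (onLine v k j) k ≡ h
    centre-ij' = trans (edgeCentre-line v k i j) centre-ij
    phase-ij : edgePhase (onLine v k i) (onLine v k j) k Phase.≋ p
    phase-ij = Phase.≋-trans (Phase.≡⇒≋ (trans (edgePhase-line v k i j)
        (cong (λ h' → radius h' (toℕ i) + (toℕ k + weightExcept (radiusOf h') v k)) centre-ij)))
      (Phase.≋-trans (Phase.≡⇒≋ (cong (_+ R) (trans (cong (radius h) (toℕ-vertex i₀≤q)) radius-i₀)))
        (Phase.subtractMod-+ p R))

  every-colour-at-vertex : ∀ a c → ∃₂ λ k x → x ≢ lookup a k × colourOf a (onLine a k x) k ≡ c
  every-colour-at-vertex a c with colour-surjective c
  ... | h , p , h<q , refl with partner h<q (toℕ≤q (lookup a (fromℕ< (Phase.subtractMod-< p (radiusSum h a)))))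
  ...   | j₀ , j₀≤q , j₀≢ , centre-j₀ = k , x , x≢ ,
      trans (colourOf-unfold a (onLine a k x) k) (colour-cong centre-x phase-x)
    where
    k : Fin d
    k = fromℕ< (Phase.subtractMod-< p (radiusSum h a))
    x = vertex j₀≤q
    x≢ : x ≢ lookup a k
    x≢ e = j₀≢ (trans (sym (toℕ-vertex j₀≤q)) (cong toℕ e))
    centre-x : edgeCentre a (onLine a k x) k ≡ h
    centre-x = trans (cong (λ z → centre (toℕ (lookup a k)) (toℕ z)) (lookup∘update k a x))
                     (trans (cong (centre (toℕ (lookup a k))) (toℕ-vertex j₀≤q)) centre-j₀)
    phase-x : edgePhase a (onLine a k x) k Phase.≋ p
    phase-x = Phase.≋-trans (Phase.≡⇒≋ (cong₂ (λ z h' → z + radiusSum h' a)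
                (toℕ-fromℕ< (Phase.subtractMod-< p (radiusSum h a))) centre-x))
              (Phase.subtractMod-+ p (radiusSum h a))

module WordEncoding (s : ℕ) where

  open import Data.Nat using (ℕ; zero; suc; _^_)
  open import Data.Fin using (Fin; zero; combine; remQuot)
  open import Data.Fin.Properties using (remQuot-combine; combine-remQuot)
  open import Data.Vec using (Vec; []; _∷_)
  open import Data.Product using (proj₁; proj₂)
  open import Relation.Binary.PropositionalEquality

  encode : ∀ {m} → Vec (Fin s) m → Fin (s ^ m)
  encode [] = zero
  encode (x ∷ xs) = combine x (encode xs)

  decode : ∀ {m} → Fin (s ^ m) → Vec (Fin s) m
  decode {zero} _ = []
  decode {suc m} i = proj₁ (remQuot {s} (s ^ m) i) ∷ decode (proj₂ (remQuot {s} (s ^ m) i))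

  decode-encode : ∀ {m} (v : Vec (Fin s) m) → decode (encode v) ≡ v
  decode-encode [] = refl
  decode-encode {suc m} (x ∷ xs) =
    cong₂ _∷_ (cong proj₁ split) (trans (cong (λ p → decode {m} (proj₂ p)) split) (decode-encode xs))
    where split = remQuot-combine {s} {s ^ m} x (encode xs)

  encode-decode : ∀ {m} (i : Fin (s ^ m)) → encode (decode {m} i) ≡ i
  encode-decode {zero} zero = refl
  encode-decode {suc m} i =
    trans (cong (combine {s} {s ^ m} (proj₁ (remQuot {s} (s ^ m) i))) (encode-decode {m} (proj₂ (remQuot {s} (s ^ m) i))))
          (combine-remQuot {s} (s ^ m) i)

  decode-injective : ∀ {m} {i j : Fin (s ^ m)} → decode {m} i ≡ decode j → i ≡ j
  decode-injective {m} {i} {j} e = trans (sym (encode-decode {m} i)) (trans (cong (encode {m}) e) (encode-decode {m} j))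

-- The vertices are cut into consecutive
-- blocks of D = r^d vertices.  A complete block (one lying inside Fin n)
-- carries a copy of the coloured Hamming graph, a vertex being identified
-- with the word numbered by its position in the block; the final incomplete
-- block, if any, is a clique of one colour; there are no edges between blocks.
module BlockGraph (f t : ℕ) (colours≤t : OneFactorisation.q f * OneFactorisation.d f ≤ t) (n : ℕ) where

  open import Data.Nat
  open import Data.Nat.Properties
  open import Data.Nat.DivMod
  open import Data.Nat.Divisibility using (divides)
  open import Data.Fin using (Fin; zero; toℕ; fromℕ<; inject≤)
  open import Data.Fin.Properties using (toℕ-injective; toℕ-fromℕ<; toℕ<n; toℕ-inject≤) renaming (_≟_ to _≟F_)
  open import Data.Maybe using (Maybe; just; nothing)
  import Data.Maybe as Maybe
  open import Data.Sum using (_⊎_; inj₁; inj₂)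
  open import Relation.Binary.PropositionalEquality
  open import Relation.Binary.Definitions using (tri<; tri≈; tri>)
  open import Relation.Nullary using (¬_; Dec; yes; no)
  open import Data.Empty using (⊥-elim)
  open import Defs using (ColGraph)

  open HammingColouring f public
  open WordEncoding r public

  blockSize : ℕ
  blockSize = wordCount

  instance
    blockSize≢0 : NonZero blockSize
    blockSize≢0 = m^n≢0 r d

  block : Fin n → ℕ
  block v = toℕ v / blockSize

  position : Fin n → Fin blockSize
  position v = fromℕ< (m%n<n (toℕ v) blockSize)

  -- (opaque, so that goals mentioning words stay small)
  opaque
    word : Fin n → Word
    word v = decode (position v)

    word-unfold : ∀ v → word v ≡ decode (position v)
    word-unfold v = refl

  Complete : ℕ → Set
  Complete h = suc h * blockSize ≤ n

  embed : Colour → Fin t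
  embed c = inject≤ c colours≤t

  embed-injective : ∀ {c c'} → embed c ≡ embed c' → c ≡ c'
  embed-injective {c} {c'} e =
    toℕ-injective (trans (sym (toℕ-inject≤ c colours≤t)) (trans (cong toℕ e) (toℕ-inject≤ c' colours≤t)))

  baseColour : Fin t
  baseColour = embed zero

  colourBy : (a b : Fin n) → Dec (block a ≡ block b) → Dec (Complete (block a)) → Dec (a ≡ b) → Maybe (Fin t)
  colourBy a b (no _) _ _ = nothing
  colourBy a b (yes _) (yes _) _ = Maybe.map embed (hammingColour (word a) (word b))
  colourBy a b (yes _) (no _) (yes _) = nothing
  colourBy a b (yes _) (no _) (no _) = just baseColour

  colourBy-sym : ∀ a b d₁ d₂ d₃ d₁' d₂' d₃' → colourBy a b d₁ d₂ d₃ ≡ colourBy b a d₁' d₂' d₃'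
  colourBy-sym a b (no _) _ _ (no _) _ _ = refl
  colourBy-sym a b (no p) _ _ (yes p') _ _ = ⊥-elim (p (sym p'))
  colourBy-sym a b (yes p) _ _ (no p') _ _ = ⊥-elim (p' (sym p))
  colourBy-sym a b (yes _) (yes _) _ (yes _) (yes _) _ = cong (Maybe.map embed) (hammingColour-sym (word a) (word b))
  colourBy-sym a b (yes p) (yes c) _ (yes _) (no c') _ = ⊥-elim (c' (subst Complete p c))
  colourBy-sym a b (yes p) (no c) _ (yes _) (yes c') _ = ⊥-elim (c (subst Complete (sym p) c'))
  colourBy-sym a b (yes _) (no _) (yes _) (yes _) (no _) (yes _) = refl
  colourBy-sym a b (yes _) (no _) (no _) (yes _) (no _) (no _) = refl
  colourBy-sym a b (yes _) (no _) (yes e) (yes _) (no _) (no e') = ⊥-elim (e' (sym e))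
  colourBy-sym a b (yes _) (no _) (no e) (yes _) (no _) (yes e') = ⊥-elim (e (sym e'))

  colourBy-refl : ∀ a d₁ d₂ d₃ → colourBy a a d₁ d₂ d₃ ≡ nothing
  colourBy-refl a (no _) _ _ = refl
  colourBy-refl a (yes _) (yes _) _ = cong (Maybe.map embed) (hammingColour-refl (word a))
  colourBy-refl a (yes _) (no _) (yes _) = refl
  colourBy-refl a (yes _) (no _) (no a≢a) = ⊥-elim (a≢a refl)

  colourBy-complete : ∀ a b d₁ d₂ d₃ → block a ≡ block b → Complete (block a) →
                      colourBy a b d₁ d₂ d₃ ≡ Maybe.map embed (hammingColour (word a) (word b))
  colourBy-complete a b (no p) _ _ e _ = ⊥-elim (p e)
  colourBy-complete a b (yes _) (yes _) _ _ _ = refl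
  colourBy-complete a b (yes _) (no c) _ _ c' = ⊥-elim (c c')

  colourBy-incomplete : ∀ a b d₁ d₂ d₃ → block a ≡ block b → ¬ Complete (block a) → a ≢ b →
                        colourBy a b d₁ d₂ d₃ ≡ just baseColour
  colourBy-incomplete a b (no p) _ _ e _ _ = ⊥-elim (p e)
  colourBy-incomplete a b (yes _) (yes c) _ _ c' _ = ⊥-elim (c' c)
  colourBy-incomplete a b (yes _) (no _) (yes e) _ _ a≢b = ⊥-elim (a≢b e)
  colourBy-incomplete a b (yes _) (no _) (no _) _ _ _ = refl

  colourBy-block : ∀ a b d₁ d₂ d₃ {c} → colourBy a b d₁ d₂ d₃ ≡ just c → block a ≡ block b
  colourBy-block a b (no _) _ _ ()
  colourBy-block a b (yes p) _ _ _ = p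

  sameBlock? : (a b : Fin n) → Dec (block a ≡ block b)
  sameBlock? a b = block a ≟ block b

  complete? : (a : Fin n) → Dec (Complete (block a))
  complete? a = suc (block a) * blockSize ≤? n

  opaque
    blockColour : Fin n → Fin n → Maybe (Fin t)
    blockColour a b = colourBy a b (sameBlock? a b) (complete? a) (a ≟F b)

    blockColour-sym : ∀ a b → blockColour a b ≡ blockColour b a
    blockColour-sym a b =
      colourBy-sym a b (sameBlock? a b) (complete? a) (a ≟F b) (sameBlock? b a) (complete? b) (b ≟F a)

    blockColour-refl : ∀ a → blockColour a a ≡ nothing
    blockColour-refl a = colourBy-refl a (sameBlock? a a) (complete? a) (a ≟F a)

    blockColour-complete : ∀ {a b} → block a ≡ block b → Complete (block a) →
                           blockColour a b ≡ Maybe.map embed (hammingColour (word a) (word b))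
    blockColour-complete {a} {b} = colourBy-complete a b (sameBlock? a b) (complete? a) (a ≟F b)

    blockColour-incomplete : ∀ {a b} → block a ≡ block b → ¬ Complete (block a) → a ≢ b →
                             blockColour a b ≡ just baseColour
    blockColour-incomplete {a} {b} = colourBy-incomplete a b (sameBlock? a b) (complete? a) (a ≟F b)

    blockColour-block : ∀ {a b c} → blockColour a b ≡ just c → block a ≡ block b
    blockColour-block {a} {b} = colourBy-block a b (sameBlock? a b) (complete? a) (a ≟F b)

  blockGraph : ColGraph n t
  blockGraph = record { col = blockColour ; sym = blockColour-sym ; irref = blockColour-refl }

  toℕ-split : ∀ (v : Fin n) → toℕ v ≡ block v * blockSize + toℕ (position v)
  toℕ-split v = trans (m≡m%n+[m/n]*n (toℕ v) blockSize)
    (trans (+-comm (toℕ v % blockSize) (block v * blockSize))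
           (cong (block v * blockSize +_) (sym (toℕ-fromℕ< (m%n<n (toℕ v) blockSize)))))

  vertexAt : ∀ h → Complete h → Fin blockSize → Fin n
  vertexAt h complete p = fromℕ< in-range
    where
    in-range : h * blockSize + toℕ p < n
    in-range = ≤-trans (≤-trans (+-monoʳ-< (h * blockSize) (toℕ<n p)) (≤-reflexive (+-comm (h * blockSize) blockSize)))
                       complete

  toℕ-vertexAt : ∀ h c p → toℕ (vertexAt h c p) ≡ h * blockSize + toℕ p
  toℕ-vertexAt h c p = toℕ-fromℕ< _

  block-vertexAt : ∀ h c p → block (vertexAt h c p) ≡ h
  block-vertexAt h c p = trans (/-congˡ (toℕ-vertexAt h c p))
    (trans (+-distrib-/-∣ˡ {h * blockSize} (toℕ p) {blockSize} (divides h refl))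
    (trans (cong₂ _+_ (m*n/n≡m h blockSize) (m<n⇒m/n≡0 (toℕ<n p))) (+-identityʳ h)))

  position-vertexAt : ∀ h c p → position (vertexAt h c p) ≡ p
  position-vertexAt h c p = toℕ-injective (trans (toℕ-fromℕ< (m%n<n (toℕ (vertexAt h c p)) blockSize))
    (trans (cong (_% blockSize) (trans (toℕ-vertexAt h c p) (+-comm (h * blockSize) (toℕ p))))
    (trans ([m+kn]%n≡m%n (toℕ p) h blockSize) (m<n⇒m%n≡m (toℕ<n p)))))

  word-injective : ∀ {a b : Fin n} → block a ≡ block b → word a ≡ word b → a ≡ b
  word-injective {a} {b} same-block same-word = toℕ-injective (trans (toℕ-split a)
    (trans (cong₂ (λ x y → x * blockSize + toℕ y) same-block
      (decode-injective {d} (trans (sym (word-unfold a)) (trans same-word (word-unfold b))))) (sym (toℕ-split b))))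

  vertexAt-self : ∀ (u : Fin n) (c : Complete (block u)) → vertexAt (block u) c (position u) ≡ u
  vertexAt-self u c = toℕ-injective (trans (toℕ-vertexAt (block u) c (position u)) (sym (toℕ-split u)))

  word-vertexAt : ∀ h c (x : Word) → word (vertexAt h c (encode x)) ≡ x
  word-vertexAt h c x = trans (word-unfold _) (trans (cong decode (position-vertexAt h c (encode x))) (decode-encode x))

  lower-complete : ∀ (a b : Fin n) → block a < block b → Complete (block a)
  lower-complete a b lt = ≤-trans (*-monoˡ-≤ blockSize lt)
    (≤-trans (≤-trans (m≤m+n (block b * blockSize) (toℕ (position b))) (≤-reflexive (sym (toℕ-split b))))
             (<⇒≤ (toℕ<n b)))

  one-complete : ∀ (a b : Fin n) → block a ≢ block b → Complete (block a) ⊎ Complete (block b)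
  one-complete a b ne with <-cmp (block a) (block b)
  ... | tri< lt _ _ = inj₁ (lower-complete a b lt)
  ... | tri≈ _ e _ = ⊥-elim (ne e)
  ... | tri> _ _ gt = inj₂ (lower-complete b a gt)

-- In rotatedClique R (on Fin (suc R)) the vertices
-- inject₁ a, for a : Fin R, form a K_R with the edge {0, 1} removed, and the
-- last vertex w is joined to 0 only.  The lemmas below invert and establish
-- its adjacency relation; R = suc m so that 0 ≠ w.
module RotatedCliqueEdges (m : ℕ) where

  open import Data.Nat using (suc)
  import Data.Nat as ℕ
  import Data.Nat.Properties as ℕ
  open import Data.Fin using (Fin; zero; toℕ; fromℕ; inject₁; lower₁)
  open import Data.Fin.Properties using (toℕ-injective; toℕ-fromℕ; toℕ-inject₁; inject₁-lower₁; inject₁-injective; toℕ<n)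
                                  renaming (_≟_ to _≟F_)
  open import Data.Bool using (Bool; true; false; if_then_else_; _∧_; _∨_; not)
  open import Data.Product using (∃; ∃₂; _×_; _,_)
  open import Data.Sum using (_⊎_; inj₁; inj₂)
  open import Relation.Binary.PropositionalEquality
  open import Relation.Nullary using (¬_; Dec; yes; no; does)
  open import Relation.Nullary.Decidable using (dec-true; dec-false)
  open import Data.Empty using (⊥-elim)
  open import Defs using (rotAdj)

  R : ℕ
  R = suc m

  last : Fin (suc R)
  last = fromℕ R

  does-true : ∀ {P : Set} (p? : Dec P) → does p? ≡ true → P
  does-true (yes p) _ = p

  does-false : ∀ {P : Set} (p? : Dec P) → does p? ≡ false → ¬ P
  does-false (no ¬p) _ = ¬p

  ∨-true : ∀ {a b} → a ∨ b ≡ true → a ≡ true ⊎ b ≡ true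
  ∨-true {true} _ = inj₁ refl
  ∨-true {false} e = inj₂ e

  ∨-false : ∀ {a b} → a ∨ b ≡ false → a ≡ false × b ≡ false
  ∨-false {false} {false} _ = refl , refl

  ∧-false : ∀ {a b} → a ∧ b ≡ false → a ≡ false ⊎ b ≡ false
  ∧-false {false} _ = inj₁ refl
  ∧-false {true} e = inj₂ e

  if-true : ∀ {c₁ c₂ c₃ c₄ : Bool} → (if c₁ then false else (if c₂ then c₃ else not c₄)) ≡ true →
            c₁ ≡ false × ((c₂ ≡ true × c₃ ≡ true) ⊎ (c₂ ≡ false × c₄ ≡ false))
  if-true {false} {true} {true} _ = refl , inj₁ (refl , refl)
  if-true {false} {false} {_} {false} _ = refl , inj₂ (refl , refl)
  if-true {true} ()
  if-true {false} {true} {false} ()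
  if-true {false} {false} {_} {true} ()

  InnerEdge : Fin (suc R) → Fin (suc R) → Set
  InnerEdge x y = ∃₂ λ (a b : Fin R) → x ≡ inject₁ a × y ≡ inject₁ b × a ≢ b ×
                  ¬ (toℕ a ≡ 0 × toℕ b ≡ 1) × ¬ (toℕ a ≡ 1 × toℕ b ≡ 0)

  Edge : Fin (suc R) → Fin (suc R) → Set
  Edge x y = InnerEdge x y ⊎ ((x ≡ zero × y ≡ last) ⊎ (x ≡ last × y ≡ zero))

  isLast : ∀ {x : Fin (suc R)} → toℕ x ≡ R → x ≡ last
  isLast e = toℕ-injective (trans e (sym (toℕ-fromℕ R)))

  notLast : ∀ (x : Fin (suc R)) → ¬ (toℕ x ≡ R) → ∃ λ a → x ≡ inject₁ a
  notLast x ne = lower₁ x (λ e → ne (sym e)) , sym (inject₁-lower₁ x (λ e → ne (sym e)))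

  edge-inv : ∀ x y → rotAdj R x y ≡ true → Edge x y
  edge-inv x y e with if-true {does (x ≟F y)} {does (toℕ x ℕ.≟ R) ∨ does (toℕ y ℕ.≟ R)}
                              {does (toℕ x ℕ.≟ 0) ∨ does (toℕ y ℕ.≟ 0)}
                              {(does (toℕ x ℕ.≟ 0) ∧ does (toℕ y ℕ.≟ 1)) ∨ (does (toℕ y ℕ.≟ 0) ∧ does (toℕ x ℕ.≟ 1))} e
  ... | _ , inj₁ (touches-w , touches-0) with ∨-true {does (toℕ x ℕ.≟ R)} touches-w
  ...   | inj₁ x-w = inj₂ (inj₂ (isLast (does-true (toℕ x ℕ.≟ R) x-w) , y-0))
    where
    y-0 : y ≡ zero
    y-0 with ∨-true {does (toℕ x ℕ.≟ 0)} touches-0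
    ... | inj₁ x-0 = ⊥-elim (ℕ.0≢1+n (trans (sym (does-true (toℕ x ℕ.≟ 0) x-0)) (does-true (toℕ x ℕ.≟ R) x-w)))
    ... | inj₂ y-0 = toℕ-injective (does-true (toℕ y ℕ.≟ 0) y-0)
  ...   | inj₂ y-w = inj₂ (inj₁ (x-0 , isLast (does-true (toℕ y ℕ.≟ R) y-w)))
    where
    x-0 : x ≡ zero
    x-0 with ∨-true {does (toℕ x ℕ.≟ 0)} touches-0
    ... | inj₁ x-0 = toℕ-injective (does-true (toℕ x ℕ.≟ 0) x-0)
    ... | inj₂ y-0 = ⊥-elim (ℕ.0≢1+n (trans (sym (does-true (toℕ y ℕ.≟ 0) y-0)) (does-true (toℕ y ℕ.≟ R) y-w)))
  edge-inv x y e | x≢y , inj₂ (avoids-w , not-removed)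
    with ∨-false {does (toℕ x ℕ.≟ R)} avoids-w
       | ∨-false {does (toℕ x ℕ.≟ 0) ∧ does (toℕ y ℕ.≟ 1)} not-removed
  ... | (x-not-w , y-not-w) | (not01 , not10)
    with notLast x (does-false (toℕ x ℕ.≟ R) x-not-w) | notLast y (does-false (toℕ y ℕ.≟ R) y-not-w)
  ...   | a , refl | b , refl = inj₁ (a , b , refl , refl , a≢b , n01 , n10)
    where
    a≢b : a ≢ b
    a≢b a≡b = does-false (inject₁ a ≟F inject₁ b) x≢y (cong inject₁ a≡b)
    n01 : ¬ (toℕ a ≡ 0 × toℕ b ≡ 1)
    n01 (a0 , b1) with ∧-false {does (toℕ (inject₁ a) ℕ.≟ 0)} not01
    ... | inj₁ p = does-false (toℕ (inject₁ a) ℕ.≟ 0) p (trans (toℕ-inject₁ a) a0)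
    ... | inj₂ p = does-false (toℕ (inject₁ b) ℕ.≟ 1) p (trans (toℕ-inject₁ b) b1)
    n10 : ¬ (toℕ a ≡ 1 × toℕ b ≡ 0)
    n10 (a1 , b0) with ∧-false {does (toℕ (inject₁ b) ℕ.≟ 0)} not10
    ... | inj₁ p = does-false (toℕ (inject₁ b) ℕ.≟ 0) p (trans (toℕ-inject₁ b) b0)
    ... | inj₂ p = does-false (toℕ (inject₁ a) ℕ.≟ 1) p (trans (toℕ-inject₁ a) a1)

  inject₁≢last : ∀ (a : Fin R) → toℕ (inject₁ a) ≢ R
  inject₁≢last a e = ℕ.<-irrefl (trans (sym (toℕ-inject₁ a)) e) (toℕ<n a)

  conjunction-false : ∀ {P Q : Set} (p? : Dec P) (q? : Dec Q) → ¬ (P × Q) → does p? ∧ does q? ≡ false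
  conjunction-false (yes p) (yes q) ¬pq = ⊥-elim (¬pq (p , q))
  conjunction-false (yes _) (no _) _ = refl
  conjunction-false (no _) _ _ = refl

  inner-edge : ∀ (a b : Fin R) → a ≢ b → ¬ (toℕ a ≡ 0 × toℕ b ≡ 1) → ¬ (toℕ a ≡ 1 × toℕ b ≡ 0) →
               rotAdj R (inject₁ a) (inject₁ b) ≡ true
  inner-edge a b a≢b n01 n10
    rewrite dec-false (inject₁ a ≟F inject₁ b) (λ e → a≢b (inject₁-injective e))
          | dec-false (toℕ (inject₁ a) ℕ.≟ R) (inject₁≢last a)
          | dec-false (toℕ (inject₁ b) ℕ.≟ R) (inject₁≢last b)
          | conjunction-false (toℕ (inject₁ a) ℕ.≟ 0) (toℕ (inject₁ b) ℕ.≟ 1)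
              (λ (p , q) → n01 (trans (sym (toℕ-inject₁ a)) p , trans (sym (toℕ-inject₁ b)) q))
          | conjunction-false (toℕ (inject₁ b) ℕ.≟ 0) (toℕ (inject₁ a) ℕ.≟ 1)
              (λ (p , q) → n10 (trans (sym (toℕ-inject₁ a)) q , trans (sym (toℕ-inject₁ b)) p)) = refl

  rotated-edge : rotAdj R zero last ≡ true
  rotated-edge rewrite dec-true (toℕ last ℕ.≟ R) (toℕ-fromℕ R) = refl

-- Counting: a row sum over Fin n whose terms are bounded by the indicator of
-- a window [S, S + D) is at most D.  This bounds the degrees in the block
-- graph, since all neighbours of a vertex lie in its block.
module WindowCount (D : ℕ) where

  open import Data.Nat
  open import Data.Nat.Properties
  open import Data.Fin using (Fin; zero; suc; toℕ)
  open import Data.List using (tabulate; map; allFin)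
  open import Data.List.Properties using (map-tabulate)
  open import Data.Nat.ListAction using (sum)
  open import Relation.Binary.PropositionalEquality
  open import Relation.Nullary using (Dec; yes; no)
  open import Data.Empty using (⊥-elim)

  indicator : ∀ {P Q : Set} → Dec P → Dec Q → ℕ
  indicator (yes _) (yes _) = 1
  indicator (yes _) (no _) = 0
  indicator (no _) _ = 0

  window : ℕ → ℕ → ℕ
  window S x = indicator (S ≤? x) (x <? S + D)

  window-in : ∀ {S x} → S ≤ x → x < S + D → window S x ≡ 1
  window-in {S} {x} = inside-case (S ≤? x) (x <? S + D)
    where
    inside-case : ∀ {P Q : Set} (p? : Dec P) (q? : Dec Q) → P → Q → indicator p? q? ≡ 1
    inside-case (yes _) (yes _) _ _ = refl
    inside-case (yes _) (no ¬q) _ q = ⊥-elim (¬q q)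
    inside-case (no ¬p) _ p _ = ⊥-elim (¬p p)

  data WindowCase (S x : ℕ) : Set where
    inside : S ≤ x → x < S + D → WindowCase S x
    outside : window S x ≡ 0 → WindowCase S x

  windowCase : ∀ S x → WindowCase S x
  windowCase S x = classify (S ≤? x) (x <? S + D) refl
    where
    classify : (p? : Dec (S ≤ x)) (q? : Dec (x < S + D)) → indicator p? q? ≡ window S x → WindowCase S x
    classify (yes S≤x) (yes x<S+D) _ = inside S≤x x<S+D
    classify (yes _) (no _) e = outside (sym e)
    classify (no _) _ e = outside (sym e)

  window-sum : ∀ n off (g : Fin n → ℕ) S → (∀ j → g j ≤ window S (off + toℕ j)) →
               sum (tabulate g) ≤ (S + D) ∸ (off ⊔ S)
  window-sum zero off g S bound = z≤n
  window-sum (suc n) off g S bound with windowCase S off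
  ... | inside S≤off off<S+D = ≤-trans (+-mono-≤ first rest) (≤-reflexive one-more)
    where
    first : g zero ≤ 1
    first = ≤-trans (bound zero) (≤-reflexive (trans (cong (window S) (+-identityʳ off)) (window-in S≤off off<S+D)))
    rest : sum (tabulate (λ j → g (suc j))) ≤ (S + D) ∸ (suc off ⊔ S)
    rest = window-sum n (suc off) (λ j → g (suc j)) S
             (λ j → ≤-trans (bound (suc j)) (≤-reflexive (cong (window S) (+-suc off (toℕ j)))))
    one-more : 1 + ((S + D) ∸ (suc off ⊔ S)) ≡ (S + D) ∸ (off ⊔ S)
    one-more = trans (cong (λ z → 1 + ((S + D) ∸ z)) (m≥n⇒m⊔n≡m (m≤n⇒m≤1+n S≤off)))
               (trans (sym (+-∸-assoc 1 off<S+D)) (cong ((S + D) ∸_) (sym (m≥n⇒m⊔n≡m S≤off))))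
  ... | outside w≡0 = ≤-trans (+-mono-≤ first rest) (∸-monoʳ-≤ (S + D) (⊔-monoˡ-≤ S (n≤1+n off)))
    where
    first : g zero ≤ 0
    first = ≤-trans (bound zero) (≤-reflexive (trans (cong (window S) (+-identityʳ off)) w≡0))
    rest : sum (tabulate (λ j → g (suc j))) ≤ (S + D) ∸ (suc off ⊔ S)
    rest = window-sum n (suc off) (λ j → g (suc j)) S
             (λ j → ≤-trans (bound (suc j)) (≤-reflexive (cong (window S) (+-suc off (toℕ j)))))

  row-sum : ∀ n (g : Fin n → ℕ) S → (∀ j → g j ≤ window S (toℕ j)) → sum (map g (allFin n)) ≤ D
  row-sum n g S bound = ≤-trans (≤-reflexive (cong sum (map-tabulate (λ x → x) g)))
    (≤-trans (window-sum n 0 g S bound) (≤-reflexive (trans (cong ((S + D) ∸_) (⊔-identityˡ S)) (m+n∸m≡n S D))))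

  sum-bound : ∀ n (g : Fin n → ℕ) K → (∀ j → g j ≤ K) → sum (map g (allFin n)) ≤ n * K
  sum-bound n g K bound = ≤-trans (≤-reflexive (cong sum (map-tabulate (λ x → x) g))) (tabulated n g bound)
    where
    tabulated : ∀ n (g : Fin n → ℕ) → (∀ j → g j ≤ K) → sum (tabulate g) ≤ n * K
    tabulated zero g _ = z≤n
    tabulated (suc n) g bound = +-mono-≤ (bound zero) (tabulated n (λ j → g (suc j)) (λ j → bound (suc j)))

module FiniteMaps where

  open import Data.Nat using (suc)
  open import Data.Nat.Properties using (<-irrefl)
  open import Data.Fin using (Fin; punchOut)
  open import Data.Fin.Properties using (punchOut-injective; injective⇒≤; any?; _≟_)
  open import Data.Product using (∃; _,_)
  open import Relation.Binary.PropositionalEquality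
  open import Relation.Nullary using (yes; no)
  open import Data.Empty using (⊥-elim)
  open import Function.Definitions using (Injective)

  injective⇒surjective : ∀ {m} (g : Fin (suc m) → Fin (suc m)) → Injective _≡_ _≡_ g → ∀ y → ∃ λ x → g x ≡ y
  injective⇒surjective {m} g g-injective y with any? (λ x → g x ≟ y)
  ... | yes hit = hit
  ... | no missed = ⊥-elim (<-irrefl refl (injective⇒≤ squeezed-injective))
    where
    -- missing y, g factors through Fin m
    squeezed : Fin (suc m) → Fin m
    squeezed x = punchOut {i = y} {j = g x} (λ e → missed (x , sym e))
    squeezed-injective : Injective _≡_ _≡_ squeezed
    squeezed-injective {x} {x'} e =
      g-injective (punchOut-injective (λ e → missed (x , sym e)) (λ e → missed (x' , sym e)) e)

  swap : ∀ {m} → Fin m → Fin m → Fin m → Fin m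
  swap p q z with z ≟ p
  ... | yes _ = q
  ... | no _ with z ≟ q
  ...   | yes _ = p
  ...   | no _ = z

  swap-p : ∀ {m} (p q : Fin m) → swap p q p ≡ q
  swap-p p q with p ≟ p
  ... | yes _ = refl
  ... | no p≢p = ⊥-elim (p≢p refl)

  swap-q : ∀ {m} (p q : Fin m) → swap p q q ≡ p
  swap-q p q with q ≟ p
  ... | yes refl = refl
  ... | no _ with q ≟ q
  ...   | yes _ = refl
  ...   | no q≢q = ⊥-elim (q≢q refl)

  swap-other : ∀ {m} (p q z : Fin m) → z ≢ p → z ≢ q → swap p q z ≡ z
  swap-other p q z z≢p z≢q with z ≟ p
  ... | yes z≡p = ⊥-elim (z≢p z≡p)
  ... | no _ with z ≟ q
  ...   | yes z≡q = ⊥-elim (z≢q z≡q)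
  ...   | no _ = refl

  swap-involutive : ∀ {m} (p q z : Fin m) → swap p q (swap p q z) ≡ z
  swap-involutive p q z with z ≟ p
  ... | yes refl = swap-q z q
  ... | no z≢p with z ≟ q
  ...   | yes refl = swap-p p z
  ...   | no z≢q = swap-other p q z z≢p z≢q

  swap-injective : ∀ {m} (p q : Fin m) → Injective _≡_ _≡_ (swap p q)
  swap-injective p q {x} {y} e =
    trans (sym (swap-involutive p q x)) (trans (cong (swap p q) e) (swap-involutive p q y))

module NoRainbowCopy (f t : ℕ) (colours≤t : OneFactorisation.q f * OneFactorisation.d f ≤ t) (n : ℕ) where

  open import Data.Nat using (ℕ; suc)
  open import Data.Fin using (Fin; zero; suc; toℕ; inject₁)
  open import Data.Fin.Properties using (toℕ-injective; fromℕ≢inject₁; inject₁-injective) renaming (_≟_ to _≟F_)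
  open import Data.Fin.Relation.Unary.Top using (view; ‵fromℕ; ‵inj₁)
  open import Data.Vec using (lookup; _[_]≔_)
  open import Data.Vec.Properties using ([]≔-lookup; []≔-idempotent)
  open import Data.Maybe using (Maybe; just)
  import Data.Maybe as Maybe
  open import Data.Bool using (true)
  open import Data.Product using (∃; _×_; _,_; proj₁; proj₂)
  open import Data.Sum using (_⊎_; inj₁; inj₂)
  open import Relation.Binary.PropositionalEquality
  open import Relation.Nullary using (¬_; yes; no)
  open import Data.Empty using (⊥)
  open import Function.Definitions using (Injective)
  open import Defs using (rotAdj; rotatedClique; HasRainbowCopy)

  open BlockGraph f t colours≤t n public
  open RotatedCliqueEdges q public
  open FiniteMaps using (injective⇒surjective)

  v₀ v₁ v₂ v₃ : Fin (suc r)
  v₀ = zero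
  v₁ = suc zero
  v₂ = suc (suc zero)
  v₃ = suc (suc (suc zero))

  two three : Fin r
  two = suc (suc zero)
  three = suc (suc (suc zero))

  edge-23 : rotAdj r v₂ v₃ ≡ true
  edge-23 = inner-edge two three (λ ()) (λ { (() , _) }) (λ { (() , _) })

  edge-02 : rotAdj r v₀ v₂ ≡ true
  edge-02 = inner-edge zero two (λ ()) (λ { (_ , ()) }) (λ { (() , _) })

  v₀≢v₂ : v₀ ≢ v₂
  v₀≢v₂ ()

  v₂≢v₃ : v₂ ≢ v₃
  v₂≢v₃ ()

  module Copy (φ : Fin (suc r) → Fin n) (φ-injective : Injective _≡_ _≡_ φ)
              (edges : ∀ x y → rotAdj r x y ≡ true → ∃ λ c → blockColour (φ x) (φ y) ≡ just c)
              (rainbow : ∀ x y x' y' → rotAdj r x y ≡ true → rotAdj r x' y' ≡ true →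
                         blockColour (φ x) (φ y) ≡ blockColour (φ x') (φ y') → (x ≡ x' × y ≡ y') ⊎ (x ≡ y' × y ≡ x'))
              where

    h : ℕ
    h = block (φ v₂)

    same-block : ∀ x y → rotAdj r x y ≡ true → block (φ x) ≡ block (φ y)
    same-block x y adj = blockColour-block (proj₂ (edges x y adj))

    -- in the monochromatic block the edges 02 and 23 would share a colour
    incomplete-impossible : ¬ Complete h → ⊥
    incomplete-impossible incomplete with rainbow v₀ v₂ v₂ v₃ edge-02 edge-23 (trans colour-02 (sym colour-23))
      where
      colour-23 : blockColour (φ v₂) (φ v₃) ≡ just baseColour
      colour-23 = blockColour-incomplete (same-block v₂ v₃ edge-23) incomplete (λ e → v₂≢v₃ (φ-injective e))
      colour-02 : blockColour (φ v₀) (φ v₂) ≡ just baseColour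
      colour-02 = blockColour-incomplete (same-block v₀ v₂ edge-02)
                    (λ c → incomplete (subst Complete (same-block v₀ v₂ edge-02) c)) (λ e → v₀≢v₂ (φ-injective e))
    ... | inj₁ (() , _)
    ... | inj₂ (() , _)

    module InCompleteBlock (complete : Complete h) where

      A : Fin (suc r) → Word
      A x = word (φ x)

      -- the pattern is connected, so it lies in one block
      all-in-block : ∀ x → block (φ x) ≡ h
      all-in-block x with view x
      ... | ‵fromℕ = trans (sym (same-block v₀ last rotated-edge)) (same-block v₀ v₂ edge-02)
      ... | ‵inj₁ {i = a} _ with a ≟F two
      ...   | yes refl = refl
      ...   | no a≢2 = same-block (inject₁ a) v₂ (inner-edge a two a≢2 (λ { (_ , ()) }) (λ { (_ , ()) }))

      colour-image : ∀ x y → blockColour (φ x) (φ y) ≡ Maybe.map embed (hammingColour (A x) (A y))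
      colour-image x y = blockColour-complete (trans (all-in-block x) (sym (all-in-block y)))
                           (subst Complete (sym (all-in-block x)) complete)

      edge-direction : ∀ x y → rotAdj r x y ≡ true →
                       ∃ λ k → DiffAt (A x) (A y) k × blockColour (φ x) (φ y) ≡ just (embed (colourOf (A x) (A y) k))
      edge-direction x y adj = from-block-colour (proj₂ (edges x y adj))
        where
        from-hamming : ∀ {c} → hammingColour (A x) (A y) ≡ just c →
          ∃ λ k → DiffAt (A x) (A y) k × blockColour (φ x) (φ y) ≡ just (embed (colourOf (A x) (A y) k))
        from-hamming e with hammingColour-inv e
        ... | k , diff , refl = k , diff , trans (colour-image x y) (cong (Maybe.map embed) e)
        defined : ∀ {c} (m : Maybe Colour) → Maybe.map embed m ≡ just c → ∃ λ c' → m ≡ just c'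
        defined (just c') _ = c' , refl
        from-block-colour : ∀ {c} → blockColour (φ x) (φ y) ≡ just c →
          ∃ λ k → DiffAt (A x) (A y) k × blockColour (φ x) (φ y) ≡ just (embed (colourOf (A x) (A y) k))
        from-block-colour e = from-hamming (proj₂ (defined (hammingColour (A x) (A y)) (trans (sym (colour-image x y)) e)))

      -- the clique part lies on the line through A 2 in the direction of the edge 23
      k : Fin d
      k = proj₁ (edge-direction v₂ v₃ edge-23)

      base : Word
      base = A v₂

      coordinate : Fin r → Fin r
      coordinate a = lookup (A (inject₁ a)) k

      on-line : ∀ a → A (inject₁ a) ≡ onLine base k (coordinate a)
      on-line a with a ≟F two | a ≟F three
      ... | yes refl | _ = sym ([]≔-lookup base k)
      ... | no _ | yes refl = DiffAt⇒update (proj₁ (proj₂ (edge-direction v₂ v₃ edge-23)))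
      ... | no a≢2 | no a≢3 =
          subst (λ k' → A (inject₁ a) ≡ base [ k' ]≔ lookup (A (inject₁ a)) k') (sym (proj₂ directions))
                (DiffAt⇒update (proj₁ (proj₂ from-2)))
        where
        from-2 = edge-direction v₂ (inject₁ a) (inner-edge two a (λ e → a≢2 (sym e)) (λ { (() , _) }) (λ { (() , _) }))
        from-3 = edge-direction v₃ (inject₁ a) (inner-edge three a (λ e → a≢3 (sym e)) (λ { (() , _) }) (λ { (() , _) }))
        directions = triangle-direction (proj₁ (proj₂ (edge-direction v₂ v₃ edge-23)))
                                        (proj₁ (proj₂ from-3)) (proj₁ (proj₂ from-2))

      -- the r clique vertices fill the whole line
      coordinate-injective : Injective _≡_ _≡_ coordinate
      coordinate-injective {a} {b} e = inject₁-injective (φ-injective (word-injective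
        (trans (all-in-block (inject₁ a)) (sym (all-in-block (inject₁ b))))
        (trans (on-line a) (trans (cong (onLine base k) e) (sym (on-line b))))))

      coordinate-surjective : ∀ z → ∃ λ a → coordinate a ≡ z
      coordinate-surjective = injective⇒surjective coordinate coordinate-injective

      rotated = edge-direction v₀ last rotated-edge

      k' : Fin d
      k' = proj₁ rotated

      c-w : Colour
      c-w = colourOf (A v₀) (A last) k'

      -- along the line, w would coincide with a clique vertex
      same-direction-impossible : k' ≡ k → ⊥
      same-direction-impossible k'≡k = fromℕ≢inject₁ (sym (φ-injective (word-injective
          (trans (all-in-block (inject₁ a)) (sym (all-in-block last))) w-on-line)))
        where
        a = proj₁ (coordinate-surjective (lookup (A last) k))
        w-on-line : A (inject₁ a) ≡ A last
        w-on-line = trans (on-line a) (trans (cong (onLine base k) (proj₂ (coordinate-surjective (lookup (A last) k))))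
          (sym (trans (subst (λ k'' → A last ≡ A v₀ [ k'' ]≔ lookup (A last) k'') k'≡k (DiffAt⇒update (proj₁ (proj₂ rotated))))
                      (trans (cong (λ v → v [ k ]≔ lookup (A last) k) (on-line zero)) ([]≔-idempotent base k)))))

      -- otherwise the line has an edge ab of colour c_w; ab is not the missing
      -- edge 01 (colours at A 0 determine the direction), so ab and 0w clash
      other-direction-impossible : k' ≢ k → ⊥
      other-direction-impossible k'≢k = clash (rainbow (inject₁ a) (inject₁ b) v₀ last edge-ab rotated-edge
                                                (trans colour-ab (sym (proj₂ (proj₂ rotated)))))
        where
        line-edge = line-has-every-colour base k c-w
        i = proj₁ line-edge
        j = proj₁ (proj₂ line-edge)
        i≢j : i ≢ j
        i≢j = proj₁ (proj₂ (proj₂ line-edge))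
        a = proj₁ (coordinate-surjective i)
        b = proj₁ (coordinate-surjective j)
        A-a : A (inject₁ a) ≡ onLine base k i
        A-a = trans (on-line a) (cong (onLine base k) (proj₂ (coordinate-surjective i)))
        A-b : A (inject₁ b) ≡ onLine base k j
        A-b = trans (on-line b) (cong (onLine base k) (proj₂ (coordinate-surjective j)))
        diff-ab : DiffAt (A (inject₁ a)) (A (inject₁ b)) k
        diff-ab = subst₂ (λ X Y → DiffAt X Y k) (sym A-a) (sym A-b) (update-DiffAt base k i≢j)
        hamming-ab : colourOf (A (inject₁ a)) (A (inject₁ b)) k ≡ c-w
        hamming-ab = trans (cong₂ (λ X Y → colourOf X Y k) A-a A-b) (proj₂ (proj₂ (proj₂ line-edge)))
        a≢b : a ≢ b
        a≢b e = i≢j (trans (sym (proj₂ (coordinate-surjective i))) (trans (cong coordinate e) (proj₂ (coordinate-surjective j))))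
        not-01 : ¬ (toℕ a ≡ 0 × toℕ b ≡ 1)
        not-01 (a0 , b1) = k'≢k (sym (same-colour-same-direction {A v₀} {A v₁} {A last} {k} {k'}
          (subst₂ (λ X Y → colourOf (A (inject₁ X)) (A (inject₁ Y)) k ≡ c-w)
                  (toℕ-injective {i = a} {j = zero} a0) (toℕ-injective {i = b} {j = suc zero} b1) hamming-ab)))
        not-10 : ¬ (toℕ a ≡ 1 × toℕ b ≡ 0)
        not-10 (a1 , b0) = k'≢k (sym (same-colour-same-direction {A v₀} {A v₁} {A last} {k} {k'}
          (subst₂ (λ X Y → colourOf (A (inject₁ Y)) (A (inject₁ X)) k ≡ c-w)
                  (toℕ-injective {i = a} {j = suc zero} a1) (toℕ-injective {i = b} {j = zero} b0)
                  (trans (sym (colourOf-sym diff-ab)) hamming-ab))))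
        edge-ab = inner-edge a b a≢b not-01 not-10
        colour-ab : blockColour (φ (inject₁ a)) (φ (inject₁ b)) ≡ just (embed c-w)
        colour-ab = trans (colour-image (inject₁ a) (inject₁ b))
                          (trans (cong (Maybe.map embed) (hammingColour-edge diff-ab)) (cong (λ c → just (embed c)) hamming-ab))
        clash : (inject₁ a ≡ v₀ × inject₁ b ≡ last) ⊎ (inject₁ a ≡ last × inject₁ b ≡ v₀) → ⊥
        clash (inj₁ (_ , b≡w)) = fromℕ≢inject₁ (sym b≡w)
        clash (inj₂ (a≡w , _)) = fromℕ≢inject₁ (sym a≡w)

      contradiction : ⊥
      contradiction with k' ≟F k
      ... | yes k'≡k = same-direction-impossible k'≡k
      ... | no k'≢k = other-direction-impossible k'≢k

    contradiction : ⊥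
    contradiction with complete? (φ v₂)
    ... | yes complete = InCompleteBlock.contradiction complete
    ... | no incomplete = incomplete-impossible incomplete

  no-rainbow-copy : ¬ HasRainbowCopy (rotatedClique r) blockGraph
  no-rainbow-copy (φ , φ-injective , edges , rainbow) = Copy.contradiction φ φ-injective edges rainbow

-- One end, say u, lies in a complete block.  Let c be the Hamming colour
-- embedded as κ (any colour if κ is not a Hamming colour), and let the edge
-- from u to a point x of direction k have colour c.  Map the clique part onto
-- the line through u in direction k, sending 0 ↦ u and 1 ↦ x, and map w to w.
-- The missing pair 01 is exactly the edge of colour c, so the line's other
-- edges avoid κ, and the line is rainbow; w is off the line, being a
-- non-neighbour of u.
module Saturation (f t : ℕ) (colours≤t : OneFactorisation.q f * OneFactorisation.d f ≤ t) (n : ℕ) where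

  open import Data.Nat using (ℕ; suc; _<_; _<?_)
  open import Data.Fin using (Fin; zero; suc; toℕ; fromℕ<; inject₁)
  open import Data.Fin.Properties using (toℕ-injective; toℕ-fromℕ<; toℕ<n; toℕ-inject≤) renaming (_≟_ to _≟F_)
  open import Data.Fin.Relation.Unary.Top using (View; view; ‵fromℕ; ‵inj₁; view-fromℕ; view-inject₁)
  open import Data.Vec using (lookup)
  open import Data.Vec.Properties using ([]≔-lookup; lookup∘update)
  open import Data.Maybe using (Maybe; just; nothing)
  open import Data.Maybe.Properties using (just-injective)
  import Data.Maybe as Maybe
  open import Data.Product using (∃; _×_; _,_)
  open import Data.Sum using (_⊎_; inj₁; inj₂)
  open import Relation.Binary.PropositionalEquality
  open import Relation.Nullary using (¬_; Dec; yes; no)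
  open import Data.Empty using (⊥-elim)
  open import Function.Definitions using (Injective)
  open import Defs using (ColGraph; rotatedClique; HasRainbowCopy)

  open NoRainbowCopy f t colours≤t n public
  open FiniteMaps using (swap; swap-p; swap-other; swap-involutive; swap-injective)

  preimage : (κ : Fin t) → Dec (toℕ κ < q * d) → Colour
  preimage κ (yes κ<) = fromℕ< κ<
  preimage κ (no _) = zero

  embed-preimage : ∀ (κ : Fin t) (κ? : Dec (toℕ κ < q * d)) → toℕ κ < q * d → embed (preimage κ κ?) ≡ κ
  embed-preimage κ (yes κ<) _ = toℕ-injective (trans (toℕ-inject≤ (fromℕ< κ<) colours≤t) (toℕ-fromℕ< κ<))
  embed-preimage κ (no κ≮) κ< = ⊥-elim (κ≮ κ<)

  embed-misses : ∀ (κ : Fin t) → ¬ toℕ κ < q * d → ∀ c → embed c ≢ κ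
  embed-misses κ κ≮ c e = κ≮ (subst (_< q * d) (trans (sym (toℕ-inject≤ c colours≤t)) (cong toℕ e)) (toℕ<n c))

  module Completion (u w : Fin n) (G' : ColGraph n t) (κ : Fin t) (complete : Complete (block u)) (u≢w : u ≢ w)
                    (no-uw : blockColour u w ≡ nothing) (new-edge : ColGraph.col G' u w ≡ just κ)
                    (unchanged : ∀ a b → a ≢ w → b ≢ w → ColGraph.col G' a b ≡ blockColour a b)
                    (c : Colour) (c-is-κ : toℕ κ < q * d → embed c ≡ κ)
                    (k : Fin d) (x : Fin r) (x≢ : x ≢ lookup (word u) k)
                    (colour-ux : colourOf (word u) (onLine (word u) k x) k ≡ c) where

    col' : Fin n → Fin n → Maybe (Fin t)
    col' = ColGraph.col G'

    base : Word
    base = word u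

    α : Fin r
    α = lookup base k

    β : Fin r
    β = swap zero α x

    τ : Fin r → Fin r
    τ z = swap zero α (swap (suc zero) β z)

    τ-injective : Injective _≡_ _≡_ τ
    τ-injective e = swap-injective (suc zero) β (swap-injective zero α e)

    τ0 : τ zero ≡ α
    τ0 = trans (cong (swap zero α) (swap-other (suc zero) β zero (λ ()) 0≢β)) (swap-p zero α)
      where
      0≢β : zero ≢ β
      0≢β e = x≢ (trans (sym (swap-involutive zero α x)) (trans (cong (swap zero α) (sym e)) (swap-p zero α)))

    τ1 : τ (suc zero) ≡ x
    τ1 = trans (cong (swap zero α) (swap-p (suc zero) β)) (swap-involutive zero α x)

    linePoint : Fin r → Fin n
    linePoint z = vertexAt (block u) complete (encode (onLine base k z))

    word-linePoint : ∀ z → word (linePoint z) ≡ onLine base k z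
    word-linePoint z = word-vertexAt (block u) complete (onLine base k z)

    block-linePoint : ∀ z → block (linePoint z) ≡ block u
    block-linePoint z = block-vertexAt (block u) complete (encode (onLine base k z))

    linePoint-α : linePoint α ≡ u
    linePoint-α = trans (cong (vertexAt (block u) complete)
                          (trans (cong encode (trans ([]≔-lookup base k) (word-unfold u))) (encode-decode {d} (position u))))
                        (vertexAt-self u complete)

    linePoint-injective : ∀ {z z'} → linePoint z ≡ linePoint z' → z ≡ z'
    linePoint-injective {z} {z'} e = trans (sym (lookup∘update k base z))
       (trans (cong (λ v → lookup v k) (trans (sym (word-linePoint z)) (trans (cong word e) (word-linePoint z'))))
              (lookup∘update k base z'))

    colour-line : ∀ {z z'} → z ≢ z' → blockColour (linePoint z) (linePoint z') ≡ just (embed (colourOf (onLine base k z) (onLine base k z') k))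
    colour-line {z} {z'} z≢z' = trans (blockColour-complete (trans (block-linePoint z) (sym (block-linePoint z')))
                                                           (subst Complete (sym (block-linePoint z)) complete))
      (trans (cong₂ (λ X Y → Maybe.map embed (hammingColour X Y)) (word-linePoint z) (word-linePoint z'))
             (cong (Maybe.map embed) (hammingColour-edge (update-DiffAt base k z≢z'))))

    -- w is not on the line: every line point is u or a neighbour of u
    linePoint≢w : ∀ z → linePoint z ≢ w
    linePoint≢w z with z ≟F α
    ... | yes refl = λ e → u≢w (trans (sym linePoint-α) e)
    ... | no z≢α = λ e → just≢nothing (trans (sym (colour-line (λ e' → z≢α (sym e'))))
                                            (trans (cong₂ blockColour linePoint-α e) no-uw))
      where
      just≢nothing : ∀ {c : Fin t} → just c ≢ nothing
      just≢nothing ()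

    φ-by : (y : Fin (suc r)) → View y → Fin n
    φ-by _ ‵fromℕ = w
    φ-by _ (‵inj₁ {i = a} _) = linePoint (τ a)

    φ : Fin (suc r) → Fin n
    φ y = φ-by y (view y)

    -- the two defining equations of φ, which is injective since w is off the line
    φ-inner : ∀ a → φ (inject₁ a) ≡ linePoint (τ a)
    φ-inner a = cong (φ-by (inject₁ a)) (view-inject₁ a)

    φ-last : φ last ≡ w
    φ-last = cong (φ-by last) (view-fromℕ r)

    φ-injective : Injective _≡_ _≡_ φ
    φ-injective {y} {y'} = by-views (view y) (view y')
      where
      by-views : ∀ {y y'} (v : View y) (v' : View y') → φ-by y v ≡ φ-by y' v' → y ≡ y'
      by-views ‵fromℕ ‵fromℕ _ = refl
      by-views ‵fromℕ (‵inj₁ {i = b} _) e = ⊥-elim (linePoint≢w (τ b) (sym e))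
      by-views (‵inj₁ {i = a} _) ‵fromℕ e = ⊥-elim (linePoint≢w (τ a) e)
      by-views (‵inj₁ _) (‵inj₁ _) e = cong inject₁ (τ-injective (linePoint-injective e))

    colour-inner : ∀ {a b} → a ≢ b → col' (φ (inject₁ a)) (φ (inject₁ b)) ≡
                                       just (embed (colourOf (onLine base k (τ a)) (onLine base k (τ b)) k))
    colour-inner {a} {b} a≢b = trans (cong₂ col' (φ-inner a) (φ-inner b))
      (trans (unchanged (linePoint (τ a)) (linePoint (τ b)) (linePoint≢w (τ a)) (linePoint≢w (τ b)))
             (colour-line (λ e → a≢b (τ-injective e))))

    φ0 : φ v₀ ≡ u
    φ0 = trans (φ-inner zero) (trans (cong linePoint τ0) linePoint-α)

    colour-0w : col' (φ v₀) (φ last) ≡ just κ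
    colour-0w = trans (cong₂ col' φ0 φ-last) new-edge

    colour-w0 : col' (φ last) (φ v₀) ≡ just κ
    colour-w0 = trans (ColGraph.sym G' (φ last) (φ v₀)) colour-0w

    coloured : ∀ y y' → Edge y y' → ∃ λ c' → col' (φ y) (φ y') ≡ just c'
    coloured _ _ (inj₁ (a , b , refl , refl , a≢b , _ , _)) = _ , colour-inner a≢b
    coloured _ _ (inj₂ (inj₁ (refl , refl))) = κ , colour-0w
    coloured _ _ (inj₂ (inj₂ (refl , refl))) = κ , colour-w0

    -- the edge of colour c on the line is the image of the missing pair 01
    colour-01 : colourOf (onLine base k (τ zero)) (onLine base k (τ (suc zero))) k ≡ c
    colour-01 = trans (cong₂ (λ X Y → colourOf X Y k) (trans (cong (onLine base k) τ0) ([]≔-lookup base k))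
                                                      (cong (onLine base k) τ1)) colour-ux

    τ0≢τ1 : τ zero ≢ τ (suc zero)
    τ0≢τ1 e = x≢ (trans (sym τ1) (trans (sym e) τ0))

    -- no clique edge of the copy has colour κ, by rainbowness of the line
    inner-avoids-κ : ∀ a b → a ≢ b → ¬ (toℕ a ≡ 0 × toℕ b ≡ 1) → ¬ (toℕ a ≡ 1 × toℕ b ≡ 0) →
                     embed (colourOf (onLine base k (τ a)) (onLine base k (τ b)) k) ≢ κ
    inner-avoids-κ a b a≢b not-01 not-10 e with toℕ κ <? q * d
    ... | no κ≮ = embed-misses κ κ≮ _ e
    ... | yes κ< with line-rainbow base k (λ e' → a≢b (τ-injective e')) τ0≢τ1
                        (trans (embed-injective (trans e (sym (c-is-κ κ<)))) (sym colour-01))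
    ...   | inj₁ (ea , eb) = not-01 (cong toℕ (τ-injective ea) , cong toℕ (τ-injective eb))
    ...   | inj₂ (ea , eb) = not-10 (cong toℕ (τ-injective ea) , cong toℕ (τ-injective eb))

    SameEdge : (y₁ y₂ y₃ y₄ : Fin (suc r)) → Set
    SameEdge y₁ y₂ y₃ y₄ = (y₁ ≡ y₃ × y₂ ≡ y₄) ⊎ (y₁ ≡ y₄ × y₂ ≡ y₃)

    inner-inner : ∀ {a b a' b'} → (τ a ≡ τ a' × τ b ≡ τ b') ⊎ (τ a ≡ τ b' × τ b ≡ τ a') →
                  SameEdge (inject₁ a) (inject₁ b) (inject₁ a') (inject₁ b')
    inner-inner (inj₁ (ea , eb)) = inj₁ (cong inject₁ (τ-injective ea) , cong inject₁ (τ-injective eb))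
    inner-inner (inj₂ (ea , eb)) = inj₂ (cong inject₁ (τ-injective ea) , cong inject₁ (τ-injective eb))

    distinct : ∀ y₁ y₂ y₃ y₄ → Edge y₁ y₂ → Edge y₃ y₄ →
               col' (φ y₁) (φ y₂) ≡ col' (φ y₃) (φ y₄) → SameEdge y₁ y₂ y₃ y₄
    distinct _ _ _ _ (inj₁ (a , b , refl , refl , a≢b , _ , _)) (inj₁ (a' , b' , refl , refl , a'≢b' , _ , _)) e =
      inner-inner (line-rainbow base k (λ e' → a≢b (τ-injective e')) (λ e' → a'≢b' (τ-injective e'))
        (embed-injective (just-injective (trans (sym (colour-inner a≢b)) (trans e (colour-inner a'≢b'))))))
    distinct _ _ _ _ (inj₁ (a , b , refl , refl , a≢b , n01 , n10)) (inj₂ (inj₁ (refl , refl))) e =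
      ⊥-elim (inner-avoids-κ a b a≢b n01 n10 (just-injective (trans (sym (colour-inner a≢b)) (trans e colour-0w))))
    distinct _ _ _ _ (inj₁ (a , b , refl , refl , a≢b , n01 , n10)) (inj₂ (inj₂ (refl , refl))) e =
      ⊥-elim (inner-avoids-κ a b a≢b n01 n10 (just-injective (trans (sym (colour-inner a≢b)) (trans e colour-w0))))
    distinct _ _ _ _ (inj₂ (inj₁ (refl , refl))) (inj₁ (a , b , refl , refl , a≢b , n01 , n10)) e =
      ⊥-elim (inner-avoids-κ a b a≢b n01 n10 (just-injective (trans (sym (colour-inner a≢b)) (trans (sym e) colour-0w))))
    distinct _ _ _ _ (inj₂ (inj₂ (refl , refl))) (inj₁ (a , b , refl , refl , a≢b , n01 , n10)) e =
      ⊥-elim (inner-avoids-κ a b a≢b n01 n10 (just-injective (trans (sym (colour-inner a≢b)) (trans (sym e) colour-w0))))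
    distinct _ _ _ _ (inj₂ (inj₁ (refl , refl))) (inj₂ (inj₁ (refl , refl))) _ = inj₁ (refl , refl)
    distinct _ _ _ _ (inj₂ (inj₁ (refl , refl))) (inj₂ (inj₂ (refl , refl))) _ = inj₂ (refl , refl)
    distinct _ _ _ _ (inj₂ (inj₂ (refl , refl))) (inj₂ (inj₁ (refl , refl))) _ = inj₂ (refl , refl)
    distinct _ _ _ _ (inj₂ (inj₂ (refl , refl))) (inj₂ (inj₂ (refl , refl))) _ = inj₁ (refl , refl)

    rainbow-copy : HasRainbowCopy (rotatedClique r) G'
    rainbow-copy = φ , φ-injective , (λ y y' adj → coloured y y' (edge-inv y y' adj)) ,
                   (λ y₁ y₂ y₃ y₄ adj adj' → distinct y₁ y₂ y₃ y₄ (edge-inv y₁ y₂ adj) (edge-inv y₃ y₄ adj'))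

  completion : ∀ (u w : Fin n) (G' : ColGraph n t) (κ : Fin t) → Complete (block u) → u ≢ w →
               blockColour u w ≡ nothing → ColGraph.col G' u w ≡ just κ →
               (∀ a b → a ≢ w → b ≢ w → ColGraph.col G' a b ≡ blockColour a b) → HasRainbowCopy (rotatedClique r) G'
  completion u w G' κ complete u≢w no-uw new-edge unchanged
    with every-colour-at-vertex (word u) (preimage κ (toℕ κ <? q * d))
  ... | k , x , x≢ , colour-ux = Completion.rainbow-copy u w G' κ complete u≢w no-uw new-edge unchanged
                                   (preimage κ (toℕ κ <? q * d)) (embed-preimage κ (toℕ κ <? q * d)) k x x≢ colour-ux

module BlockGraphProperties (f t : ℕ) (colours≤t : OneFactorisation.q f * OneFactorisation.d f ≤ t) (n : ℕ) where

  open import Data.Nat using (ℕ; suc; z≤n; _+_; _*_; _≤_; _<_)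
  open import Data.Nat.Properties using (≤-trans; ≤-reflexive; *-comm; m≤m+n; +-monoʳ-<)
  open import Data.Fin using (Fin; toℕ)
  open import Data.Fin.Properties using (toℕ<n) renaming (_≟_ to _≟F_)
  open import Data.Maybe using (Maybe; just; nothing; is-just)
  open import Data.Bool using (Bool; true; false; if_then_else_; _∧_; _∨_)
  open import Data.Bool.Properties using (∨-zeroʳ; ∧-zeroʳ)
  open import Data.Sum using (inj₁; inj₂)
  open import Relation.Binary.PropositionalEquality
  open import Relation.Nullary using (yes; no; does)
  open import Relation.Nullary.Decidable using (dec-true; dec-false)
  open import Defs using (addEdge; rotatedClique; HasRainbowCopy; edgeCount)

  open Saturation f t colours≤t n public

  -- the test by which addEdge decides that ab is the new pair ij: adding ij
  -- in colour κ colours ab by  if hit i j a b then just κ else blockColour a b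
  hit : Fin n → Fin n → Fin n → Fin n → Bool
  hit i j a b = (does (a ≟F i) ∧ does (b ≟F j)) ∨ (does (a ≟F j) ∧ does (b ≟F i))

  hit-ij : ∀ i j → hit i j i j ≡ true
  hit-ij i j rewrite dec-true (i ≟F i) refl | dec-true (j ≟F j) refl = refl

  hit-ji : ∀ i j → hit i j j i ≡ true
  hit-ji i j rewrite dec-true (i ≟F i) refl | dec-true (j ≟F j) refl = ∨-zeroʳ _

  miss-j : ∀ i j a b → a ≢ j → b ≢ j → hit i j a b ≡ false
  miss-j i j a b a≢j b≢j rewrite dec-false (a ≟F j) a≢j | dec-false (b ≟F j) b≢j = cong (_∨ false) (∧-zeroʳ _)

  miss-i : ∀ i j a b → a ≢ i → b ≢ i → hit i j a b ≡ false
  miss-i i j a b a≢i b≢i rewrite dec-false (a ≟F i) a≢i | dec-false (b ≟F i) b≢i = cong (false ∨_) (∧-zeroʳ _)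

  added-at-i : ∀ i j (i≢j : i ≢ j) → blockColour i j ≡ nothing → ∀ κ → Complete (block i) →
               HasRainbowCopy (rotatedClique r) (addEdge blockGraph i j i≢j κ)
  added-at-i i j i≢j no-ij κ complete = completion i j (addEdge blockGraph i j i≢j κ) κ complete i≢j no-ij
    (cong (λ h → if h then just κ else blockColour i j) (hit-ij i j))
    (λ a b a≢j b≢j → cong (λ h → if h then just κ else blockColour a b) (miss-j i j a b a≢j b≢j))

  added-at-j : ∀ i j (i≢j : i ≢ j) → blockColour i j ≡ nothing → ∀ κ → Complete (block j) →
               HasRainbowCopy (rotatedClique r) (addEdge blockGraph i j i≢j κ)
  added-at-j i j i≢j no-ij κ complete = completion j i (addEdge blockGraph i j i≢j κ) κ complete
    (λ e → i≢j (sym e)) (trans (blockColour-sym j i) no-ij)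
    (cong (λ h → if h then just κ else blockColour j i) (hit-ji i j))
    (λ a b a≢i b≢i → cong (λ h → if h then just κ else blockColour a b) (miss-i i j a b a≢i b≢i))

  -- adding a non-edge ij in colour κ creates a rainbow copy: within a block
  -- the block is complete (the incomplete one is a clique), and between
  -- blocks the lower one is complete
  saturating : ∀ i j (i≢j : i ≢ j) → blockColour i j ≡ nothing → ∀ κ →
               HasRainbowCopy (rotatedClique r) (addEdge blockGraph i j i≢j κ)
  saturating i j i≢j no-ij κ with sameBlock? i j
  ... | yes same with complete? i
  ...   | yes complete = added-at-i i j i≢j no-ij κ complete
  ...   | no incomplete with trans (sym (blockColour-incomplete same incomplete i≢j)) no-ij
  ...     | ()
  saturating i j i≢j no-ij κ | no different with one-complete i j different
  ... | inj₁ complete = added-at-i i j i≢j no-ij κ complete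
  ... | inj₂ complete = added-at-j i j i≢j no-ij κ complete

  open WindowCount blockSize

  row-term : ∀ (b : Bool) (m : Maybe (Fin t)) K → (∀ c → m ≡ just c → 1 ≤ K) → (if b ∧ is-just m then 1 else 0) ≤ K
  row-term false m K _ = z≤n
  row-term true nothing K _ = z≤n
  row-term true (just c) K edge = edge c refl

  in-window : ∀ i j → block i ≡ block j → 1 ≤ window (block i * blockSize) (toℕ j)
  in-window i j same = ≤-reflexive (sym (window-in below above))
    where
    j-split : toℕ j ≡ block i * blockSize + toℕ (position j)
    j-split = trans (toℕ-split j) (cong (λ h → h * blockSize + toℕ (position j)) (sym same))
    below : block i * blockSize ≤ toℕ j
    below = ≤-trans (m≤m+n (block i * blockSize) (toℕ (position j))) (≤-reflexive (sym j-split))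
    above : toℕ j < block i * blockSize + blockSize
    above = ≤-trans (≤-reflexive (cong suc j-split)) (+-monoʳ-< (block i * blockSize) (toℕ<n (position j)))

  -- each row has at most blockSize edges
  edge-bound : edgeCount blockGraph ≤ blockSize * n
  edge-bound = ≤-trans (sum-bound n _ blockSize (λ i → row-sum n _ (block i * blockSize)
                 (λ j → row-term _ (blockColour i j) _ (λ c e → in-window i j (blockColour-block e)))))
               (≤-reflexive (*-comm n blockSize))

open import Data.Nat using (suc; s≤s)
open import Data.Nat.Properties using (*-identityʳ; *-assoc)
open import Data.Nat.DivMod using (_/_; m*n/n≡m)
open import Data.Nat.Divisibility using (_∣_; divides)
open import Data.Nat.Combinatorics using (_C_)
open import Data.Product using (∃; _,_)
open import Relation.Binary.PropositionalEquality using (_≡_; refl; cong; trans; subst) renaming (sym to ≡-sym)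

even-at-least-four : ∀ {r} → 4 ≤ r → 2 ∣ r → ∃ λ f → r ≡ suc (suc f) * 2
even-at-least-four () (divides 0 refl)
even-at-least-four (s≤s (s≤s ())) (divides 1 refl)
even-at-least-four _ (divides (suc (suc f)) r≡) = f , r≡

-- binom(2d, 2) = (2d - 1) · d = q · d, the number of Hamming colours
-- (binom(n, 2) unfolds to n(n - 1)/2)
binomial-r-2 : ∀ f → (suc (suc f) * 2) C 2 ≡ OneFactorisation.q f * OneFactorisation.d f
binomial-r-2 f = trans (cong (_/ 2) (trans (cong (q *_) (*-identityʳ (d * 2))) (≡-sym (*-assoc q d 2))))
                       (m*n/n≡m (q * d) 2)
  where open OneFactorisation f using (q; d)

saturation-number-linear : ∀ f t → (suc (suc f) * 2) C 2 ≤ t →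
  ∃ λ K → (n : ℕ) → SatAtMost t (rotatedClique (suc (suc f) * 2)) n (K * n)
saturation-number-linear f t binomial≤t = HammingColouring.wordCount f , λ n →
  let open BlockGraphProperties f t (subst (_≤ t) (binomial-r-2 f) binomial≤t) n
  in blockGraph , (no-rainbow-copy , saturating) , edge-bound

-- Theorem 3.12: sat_t(n, 𝔑(H)) = O(n); the linear bound even holds for all n
theorem3p12 : (r : ℕ) → 4 ≤ r → 2 ∣ r → (t : ℕ) → r C 2 ≤ t →
    ∃ λ (K : ℕ) → ∃ λ (N : ℕ) → (n : ℕ) → N ≤ n →
      SatAtMost t (rotatedClique r) n (K * n)
theorem3p12 r 4≤r 2∣r t binomial≤t with even-at-least-four 4≤r 2∣r
... | f , refl with saturation-number-linear f t binomial≤t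
...   | K , bound = K , 0 , λ n _ → bound n
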